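{- Let $X,Y$ be lower Eulerian posets with rank functions $\rho_X,\rho_Y$, let $\sigma:X\to Y$ be a strong formal subdivision, and let $\Gamma$ be the associated poset (non-Hausdorff mapping cylinder) described in the context. Fix a weak rank function $r_\Gamma\in I(\Gamma)$ and an element $\kappa_\Gamma\in\mathcal{I}(\Gamma)\cap U(\Gamma)$ that is multiplicative and rank alternating. Then \[ g_\Gamma|_{X/Y}=\Delta\ell_\sigma\cdot g_\Gamma=\Delta\ell_\sigma\cdot g_\Gamma|_Y .\] That is, for all $x\in X$, $y\in Y$ with $\sigma(x)\le y$, \[ g_\Gamma(x,y)=\sum_{\sigma(x)\le y'\le y}\Delta\ell_\sigma(x,y')\,g_Y(y',y).\]
   Context: All posets are finite. For a poset $B$, $\mathrm{Int}(B)$ is the set of closed intervals $[z,z']$ ($z\le z'$). The incidence algebra $I(B)$ is the set of functions $p:\mathrm{Int}(B)\to\mathbb{Z}[t]$ (value written $p(z,z')=p(z,z';t)$), a $\mathbb{Z}[t]$-algebra with pointwise addition and scalar multiplication, product $(p\cdot p')(z,z')=\sum_{z\le z''\le z'}p(z,z'')p'(z'',z')$, and unit $\delta_B$ ($\delta_B(z,z)=1$, $\delta_B(z,z')=0$ for $z\ne z'$). A weak rank function is $r_B\in I(B)$ with $r_B(z,z')\in\mathbb{Z}_{\ge0}$, $r_B(z,z')>0$ for $z<z'$, and $r_B(z,z')=r_B(z,z'')+r_B(z'',z')$ for $z\le z''\le z'$. Given $r_B$: $\mathcal{I}(B)=\{p\in I(B):\deg p(z,z')\le r_B(z,z')\ \forall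 z\le z'\}$ (with $\deg 0=-\infty$), with the ring involution $p^{\mathrm{rev}}(z,z';t)=t^{r_B(z,z')}p(z,z';t^{ -1})$; $\mathcal{I}_{1/2}(B)=\{p\in\mathcal{I}(B):\deg p(z,z')<r_B(z,z')/2\ \forall z<z'\}$; $U(B)=\{p:p(z,z)=1\ \forall z\}$. A $B$-kernel is $\kappa_B\in\mathcal{I}(B)\cap U(B)$ with $\kappa_B^{ -1}=\kappa_B^{\mathrm{rev}}$; for it there are unique $f_B,g_B\in\mathcal{I}_{1/2}(B)\cap U(B)$ with $f_B^{\mathrm{rev}}=\kappa_B\cdot f_B$ and $g_B^{\mathrm{rev}}=g_B\cdot\kappa_B$ (right and left Kazhdan–Lusztig–Stanley functions). For $p\in\mathcal{I}(B)$, $\Delta p\in\mathcal{I}_{1/2}(B)$ is given by $(\Delta p)(z,z)=0$ and, for $z<z'$ with $p(z,z')=\sum_i a_it^i$, $(\Delta p)(z,z')=a_0+\sum_{i=1}^{\lfloor (r_B(z,z')-1)/2\rfloor}(a_i-a_{i-1})t^i$. A poset $B$ is lower Eulerian if it has a unique minimal element, admits a rank function $\rho_B:B\to\mathbb{Z}$ (with $\rho_B(z')=\rho_B(z)+1$ whenever $z'$ covers $z$), and $\sum_{z\le z''\le z'}(-1)^{\rho_B(z'')}=0$ for all $z<z'$; write $\rho_B(z,z')=\rho_B(z')-\rho_B(z)$. For lower Eulerian $B$ (with any weak rank function $r_B$, not necessarily $\rho_B$), $\widehat{p}(z,z')=(-1)^{\rho_B(z,z')}p(z,z')$; $p\in\mathcal{I}(B)$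 is rank alternating if $p^{\mathrm{rev}}=\widehat p$, and multiplicative if $p(z,z')=p(z,z'')p(z'',z')$ for all $z\le z''\le z'$. A multiplicative rank alternating element of $\mathcal{I}(B)\cap U(B)$ is a $B$-kernel. Setting: $X,Y$ lower Eulerian with rank functions $\rho_X,\rho_Y$; $\sigma:X\to Y$ is a strong formal subdivision, i.e. (1) order-preserving, (2) $\rho_X(x)\le\rho_Y(\sigma(x))$ for all $x$, (3) $\sigma$ is surjective and for all $x\in X,y\in Y$ with $\sigma(x)\le y$ there is $x'\ge x$ in $X$ with $\rho_X(x')=\rho_Y(y)$ and $\sigma(x')=y$, (4) for all $x\in X,y\in Y$ with $\sigma(x)\le y$, $\sum_{x\le x'\in X,\ \sigma(x')=y}(-1)^{\rho_Y(y)-\rho_X(x')}=1$. $\Gamma$ is the poset on the disjoint union $X\sqcup Y$ with the orders of $X$ and of $Y$, and with $x\le y$ ($x\in X,y\in Y$) iff $\sigma(x)\le y$ (no element of $Y$ is below an element of $X$); $\Gamma$ is lower Eulerian with rank function $\rho_\Gamma$ equal to $\rho_X$ on $X$ and $\rho_Y+1$ on $Y$. With the kernel $\kappa_\Gamma$, $f_\Gamma,g_\Gamma$ are its KLS functions; $f_X,g_X$ (resp. $f_Y,g_Y$) denote their restrictions to intervals in $X$ (resp. $Y$). For $p\in\mathcal{I}(\Gamma)$, $p|_X,p|_Y,p|_{X/Y},p|_{(X/Y)^\circ}$ agree with $p$ on intervals $[z,z']$ with, respectively, $z,z'\in X$; $z,z'\in Y$; $z\in X,z'\in Y$; $z\in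 X,z'=\sigma(z)$; and vanish on all other intervals. Define $h_\sigma,\ell_\sigma\in\mathcal{I}(\Gamma)$ by $(t-1)\cdot h_\sigma=g_\Gamma\cdot\kappa_\Gamma|_{(X/Y)^\circ}$ (the right side is divisible by $t-1$) and $\ell_\sigma=h_\sigma\cdot g_\Gamma^{ -1}$; $\ell_\sigma(x,y)$ is the local $h$-polynomial of $[x,y]$. -}

module Defs where

open import Data.Nat as ℕ using (ℕ; zero; suc; _∸_; _/_)
open import Data.Integer as ℤ using (ℤ; +_; -_; ∣_∣)
open import Data.List using (List; []; _∷_; map; filter; upTo; _++_; foldr)
open import Data.List.Membership.Propositional using (_∈_)
open import Data.List.Relation.Unary.Unique.Propositional using (Unique)
open import Data.Product using (Σ; _×_; _,_; ∃)
open import Data.Sum using (_⊎_; inj₁; inj₂)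
open import Data.Sum.Properties using (≡-dec)
open import Data.Empty using (⊥)
open import Relation.Nullary using (¬_)
open import Relation.Nullary.Decidable using (_×-dec_; yes; no)
open import Relation.Binary using (Decidable; IsPartialOrder; DecidableEquality)
open import Relation.Binary.PropositionalEquality using (_≡_; _≢_)

-- Polynomials in ℤ[t], as coefficient lists (lowest degree first).
-- Equality of polynomials is coefficientwise (_≈ₚ_), so trailing zeros
-- are irrelevant.

Poly : Set
Poly = List ℤ

coeff : Poly → ℕ → ℤ
coeff []       _       = + 0
coeff (a ∷ p)  zero    = a
coeff (a ∷ p)  (suc i) = coeff p i

infix 4 _≈ₚ_
_≈ₚ_ : Poly → Poly → Set
p ≈ₚ q = ∀ i → coeff p i ≡ coeff q i

infixl 6 _+ₚ_
_+ₚ_ : Poly → Poly → Poly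
[]      +ₚ q       = q
(a ∷ p) +ₚ []      = a ∷ p
(a ∷ p) +ₚ (b ∷ q) = (a ℤ.+ b) ∷ (p +ₚ q)

scaleₚ : ℤ → Poly → Poly
scaleₚ c p = map (c ℤ.*_) p

infixl 7 _*ₚ_
_*ₚ_ : Poly → Poly → Poly
[]      *ₚ q = []
(a ∷ p) *ₚ q = scaleₚ a q +ₚ (+ 0 ∷ (p *ₚ q))

sumₚ : List Poly → Poly
sumₚ = foldr _+ₚ_ []

0ₚ 1ₚ t-1 : Poly
0ₚ  = []
1ₚ  = + 1 ∷ []
t-1 = - (+ 1) ∷ + 1 ∷ []

DegLe : Poly → ℕ → Set
DegLe p d = ∀ i → d ℕ.< i → coeff p i ≡ + 0

DegLtHalf : Poly → ℕ → Set
DegLtHalf p r = ∀ i → r ℕ.≤ 2 ℕ.* i → coeff p i ≡ + 0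

-- t^r p(t⁻¹), for p of degree ≤ r
revₚ : ℕ → Poly → Poly
revₚ r p = map (λ i → coeff p (r ∸ i)) (upTo (suc r))

-- (-1)^n for n ∈ ℤ
sgn : ℤ → ℤ
sgn n = go ∣ n ∣
  where
  go : ℕ → ℤ
  go zero    = + 1
  go (suc k) = - go k

sumℤ : List ℤ → ℤ
sumℤ = foldr ℤ._+_ (+ 0)

record FinOrd : Set₁ where
  field
    Carrier : Set
    _≤_     : Carrier → Carrier → Set
    _≤?_    : Decidable _≤_
    _≟_     : DecidableEquality Carrier
    elems   : List Carrier

  _<_ : Carrier → Carrier → Set
  z < z' = z ≤ z' × z ≢ z'

  interval : Carrier → Carrier → List Carrier
  interval z z' = filter (λ w → (z ≤? w) ×-dec (w ≤? z')) elems

record FinPoset : Set₁ where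
  field
    ord            : FinOrd
  open FinOrd ord public
  field
    isPartialOrder : IsPartialOrder _≡_ _≤_
    elems-complete : ∀ x → x ∈ elems
    elems-unique   : Unique elems

-- Incidence algebra I(B): functions on pairs; only their values on
-- intervals [z , z'] (z ≤ z') matter, and all equalities below are
-- only imposed on intervals.

module _ (B : FinOrd) where
  open FinOrd B

  Inc : Set
  Inc = Carrier → Carrier → Poly

  _≈ᴵ_ : Inc → Inc → Set
  p ≈ᴵ q = ∀ z z' → z ≤ z' → p z z' ≈ₚ q z z'

  _⊛_ : Inc → Inc → Inc
  (p ⊛ q) z z' = sumₚ (map (λ w → p z w *ₚ q w z') (interval z z'))

  δ : Inc
  δ z z' with z ≟ z'
  ... | yes _ = 1ₚ
  ... | no  _ = 0ₚ

  WeakRank : Set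
  WeakRank = Carrier → Carrier → ℕ

  IsWeakRankFunction : WeakRank → Set
  IsWeakRankFunction r =
    (∀ z z' → z < z' → 0 ℕ.< r z z') ×
    (∀ z w z' → z ≤ w → w ≤ z' → r z z' ≡ r z w ℕ.+ r w z')

  InI : WeakRank → Inc → Set
  InI r p = ∀ z z' → z ≤ z' → DegLe (p z z') (r z z')

  InIHalf : WeakRank → Inc → Set
  InIHalf r p = InI r p × (∀ z z' → z < z' → DegLtHalf (p z z') (r z z'))

  InU : Inc → Set
  InU p = ∀ z → p z z ≈ₚ 1ₚ

  rev : WeakRank → Inc → Inc
  rev r p z z' = revₚ (r z z') (p z z')

  IsKernel : WeakRank → Inc → Set
  IsKernel r κ = InI r κ × InU κ × ((κ ⊛ rev r κ) ≈ᴵ δ) × ((rev r κ ⊛ κ) ≈ᴵ δ)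

  IsLeftKLS : WeakRank → Inc → Inc → Set
  IsLeftKLS r κ g = InIHalf r g × InU g × (rev r g ≈ᴵ (g ⊛ κ))

  Δ : WeakRank → Inc → Inc
  Δ r p z z' with z ≟ z'
  ... | yes _ = 0ₚ
  ... | no  _ = coeff (p z z') 0 ∷
                map (λ j → coeff (p z z') (suc j) ℤ.- coeff (p z z') j)
                    (upTo ((r z z' ∸ 1) / 2))

  Covers : Carrier → Carrier → Set
  Covers z z' = z < z' × (∀ w → z < w → w < z' → ⊥)

  IsRankFunction : (Carrier → ℤ) → Set
  IsRankFunction ρ = ∀ z z' → Covers z z' → ρ z' ≡ ρ z ℤ.+ + 1

  hat : (Carrier → ℤ) → Inc → Inc
  hat ρ p z z' = scaleₚ (sgn (ρ z' ℤ.- ρ z)) (p z z')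

  IsRankAlternating : WeakRank → (Carrier → ℤ) → Inc → Set
  IsRankAlternating r ρ p = rev r p ≈ᴵ hat ρ p

  IsMultiplicative : Inc → Set
  IsMultiplicative p = ∀ z w z' → z ≤ w → w ≤ z' → p z z' ≈ₚ (p z w *ₚ p w z')

module _ (B : FinPoset) where
  open FinPoset B

  Minimal : Carrier → Set
  Minimal m = ∀ w → w ≤ m → w ≡ m

  IsLowerEulerian : (Carrier → ℤ) → Set
  IsLowerEulerian ρ =
    (Σ Carrier λ m → Minimal m × (∀ m' → Minimal m' → m' ≡ m)) ×
    IsRankFunction ord ρ ×
    (∀ z z' → z < z' → sumℤ (map (λ w → sgn (ρ w)) (interval z z')) ≡ + 0)

module _ (X Y : FinPoset) (ρX : FinPoset.Carrier X → ℤ) (ρY : FinPoset.Carrier Y → ℤ) where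
  private
    module X = FinPoset X
    module Y = FinPoset Y

  IsStrongFormalSubdivision : (X.Carrier → Y.Carrier) → Set
  IsStrongFormalSubdivision σ =
    (∀ x x' → x X.≤ x' → σ x Y.≤ σ x') ×
    (∀ x → ρX x ℤ.≤ ρY (σ x)) ×
    (∀ y → ∃ λ x → σ x ≡ y) ×
    (∀ x y → σ x Y.≤ y → ∃ λ x' → x X.≤ x' × ρX x' ≡ ρY y × σ x' ≡ y) ×
    (∀ x y → σ x Y.≤ y →
       sumℤ (map (λ x' → sgn (ρY y ℤ.- ρX x'))
                 (filter (λ x' → (x X.≤? x') ×-dec (σ x' Y.≟ y)) X.elems))
       ≡ + 1)

  module _ (σ : X.Carrier → Y.Carrier) where

    CylLe : X.Carrier ⊎ Y.Carrier → X.Carrier ⊎ Y.Carrier → Set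
    CylLe (inj₁ x) (inj₁ x') = x X.≤ x'
    CylLe (inj₂ y) (inj₂ y') = y Y.≤ y'
    CylLe (inj₁ x) (inj₂ y)  = σ x Y.≤ y
    CylLe (inj₂ y) (inj₁ x)  = ⊥

    CylLe? : Decidable CylLe
    CylLe? (inj₁ x) (inj₁ x') = x X.≤? x'
    CylLe? (inj₂ y) (inj₂ y') = y Y.≤? y'
    CylLe? (inj₁ x) (inj₂ y)  = σ x Y.≤? y
    CylLe? (inj₂ y) (inj₁ x)  = no (λ ())

    Cyl : FinOrd
    Cyl = record
      { Carrier = X.Carrier ⊎ Y.Carrier
      ; _≤_     = CylLe
      ; _≤?_    = CylLe?
      ; _≟_     = ≡-dec X._≟_ Y._≟_
      ; elems   = map inj₁ X.elems ++ map inj₂ Y.elems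
      }

    ρCyl : X.Carrier ⊎ Y.Carrier → ℤ
    ρCyl (inj₁ x) = ρX x
    ρCyl (inj₂ y) = ρY y ℤ.+ + 1

    restrXY : Inc Cyl → Inc Cyl
    restrXY p (inj₁ x) (inj₂ y) = p (inj₁ x) (inj₂ y)
    restrXY p _ _ = 0ₚ

    restrY : Inc Cyl → Inc Cyl
    restrY p (inj₂ y) (inj₂ y') = p (inj₂ y) (inj₂ y')
    restrY p _ _ = 0ₚ

    restrXY° : Inc Cyl → Inc Cyl
    restrXY° p (inj₁ x) (inj₂ y) with σ x Y.≟ y
    ... | yes _ = p (inj₁ x) (inj₂ y)
    ... | no  _ = 0ₚ
    restrXY° p _ _ = 0ₚ

    IsHσ : Inc Cyl → Inc Cyl → Inc Cyl → Set
    IsHσ κ g h = ∀ z z' → CylLe z z' →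
      (t-1 *ₚ h z z') ≈ₚ (_⊛_ Cyl g (restrXY° κ)) z z'

    -- ℓ_σ = h_σ · g_Γ⁻¹, characterised by ℓ_σ · g_Γ = h_σ (g_Γ is invertible)
    IsLσ : Inc Cyl → Inc Cyl → Inc Cyl → Set
    IsLσ g h ℓ = _≈ᴵ_ Cyl (_⊛_ Cyl ℓ g) h

{-# OPTIONS --safe #-}
-- On intervals inside X or inside Y the restriction κ° = κ|_{(X/Y)°} vanishes, hence so
-- does h_σ, and, cancelling the unitriangular g_Γ, so do ℓ_σ and Δℓ_σ; this settles every
-- claim except the value of g_Γ on an interval [x, y] with x ∈ X and y ∈ Y.  There the
-- multiplicativity κ(x', y) = κ(x', σ(x')) κ(σ(x'), y) turns g^rev = g·κ and ℓ_σ·g = h_σ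
-- into relations between the rows g(x, ·), h_σ(x, ·), ℓ_σ(x, ·) and g_Y, κ_Y over the
-- up-set of σ(x).  By induction on y, v = g(x, y) - Σ_{σ(x) ≤ y' < y} Δℓ_σ(x, y') g(y', y)
-- has degree < r(x, y)/2 and satisfies v^rev = v + (t - 1) ℓ_σ(x, y), and these two
-- properties characterise Δℓ_σ(x, y).
module Submission where

open import Defs
open import Algebra.Bundles using (AbelianGroup)
open import Data.Empty using (⊥-elim)
open import Data.Fin using (toℕ)
open import Data.Fin.Properties using (toℕ≤pred[n])
open import Data.Integer as ℤ using (ℤ; +_; -_)
import Data.Integer.Properties as ℤP
open import Data.List using (List; []; _∷_; map; filter; _++_; upTo; applyUpTo)
open import Data.List.Membership.Propositional using (_∈_)
open import Data.List.Membership.Propositional.Properties using (∈-filter⁺; ∈-filter⁻)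
open import Data.List.Properties using (filter-all; filter-none; filter-++; ++-identityʳ)
open import Data.List.Relation.Unary.All as All using (All)
open import Data.List.Relation.Unary.Any using (here; there)
open import Data.List.Relation.Unary.Unique.Propositional using (Unique; _∷_)
import Data.List.Relation.Unary.Unique.Propositional.Properties as Unique
open import Data.Nat as ℕ using (ℕ; zero; suc; _∸_; _/_; z≤n; s≤s)
import Data.Nat.DivMod as ℕD
open import Data.Nat.Induction using (<-wellFounded)
import Data.Nat.Properties as ℕP
open import Data.Product using (_×_; _,_; proj₁; proj₂; uncurry)
open import Data.Sum using (inj₁; inj₂)
open import Data.Sum.Properties using (inj₁-injective; inj₂-injective)
open import Function using (_∘_)
open import Induction.WellFounded using (Acc; acc)
open import Relation.Binary.Bundles using (Setoid)
open import Relation.Binary.Definitions using (DecidableEquality; Transitive)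
open import Relation.Binary.PropositionalEquality
  using (_≡_; _≢_; _≗_; refl; sym; trans; cong; cong₂; subst; subst₂; ≢-sym; module ≡-Reasoning)
import Relation.Binary.Reasoning.Setoid as SetoidReasoning
open import Relation.Binary.Structures using (IsPartialOrder)
open import Relation.Nullary using (Dec; yes; no)
open import Relation.Nullary.Decidable using (¬?; _×-dec_)

open import Algebra.Properties.AbelianGroup ℤP.+-0-abelianGroup using (inverseˡ-unique; ⁻¹-anti-homo‿-)
open import Algebra.Properties.Semiring.Sum ℤP.+-*-semiring
  using (sum; sum-cong-≗; sum-replicate-zero; ∑-distrib-+; *-distribˡ-sum)

-- Polynomials up to coefficientwise equality

-- _≈ₚ_ unfolds to a function type, from which Agda cannot recover the two
-- polynomials; the record wrapper makes them inferable.
infix 4 _≋_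
record _≋_ (p q : Poly) : Set where
  constructor coeffwise
  field coeff-≡ : p ≈ₚ q
open _≋_ public

≋-refl : ∀ {p} → p ≋ p
≋-refl = coeffwise λ _ → refl

≋-sym : ∀ {p q} → p ≋ q → q ≋ p
≋-sym p≋q = coeffwise λ i → sym (coeff-≡ p≋q i)

≋-trans : ∀ {p q s} → p ≋ q → q ≋ s → p ≋ s
≋-trans p≋q q≋s = coeffwise λ i → trans (coeff-≡ p≋q i) (coeff-≡ q≋s i)

≡⇒≋ : ∀ {p q} → p ≡ q → p ≋ q
≡⇒≋ refl = ≋-refl

≋-setoid : Setoid _ _
≋-setoid = record
  { Carrier = Poly ; _≈_ = _≋_
  ; isEquivalence = record { refl = ≋-refl ; sym = ≋-sym ; trans = ≋-trans } }

module ≋-Reasoning = SetoidReasoning ≋-setoid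

negₚ : Poly → Poly
negₚ = scaleₚ (- + 1)

infixl 6 _-ₚ_
_-ₚ_ : Poly → Poly → Poly
p -ₚ q = p +ₚ negₚ q

coeff-+ₚ : ∀ p q i → coeff (p +ₚ q) i ≡ coeff p i ℤ.+ coeff q i
coeff-+ₚ []      q       i       = sym (ℤP.+-identityˡ _)
coeff-+ₚ (a ∷ p) []      i       = sym (ℤP.+-identityʳ _)
coeff-+ₚ (a ∷ p) (b ∷ q) zero    = refl
coeff-+ₚ (a ∷ p) (b ∷ q) (suc i) = coeff-+ₚ p q i

coeff-scaleₚ : ∀ c p i → coeff (scaleₚ c p) i ≡ c ℤ.* coeff p i
coeff-scaleₚ c []      i       = sym (ℤP.*-zeroʳ c)
coeff-scaleₚ c (a ∷ p) zero    = refl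
coeff-scaleₚ c (a ∷ p) (suc i) = coeff-scaleₚ c p i

coeff-negₚ : ∀ p i → coeff (negₚ p) i ≡ - coeff p i
coeff-negₚ p i = trans (coeff-scaleₚ (- + 1) p i) (ℤP.-1*i≡-i (coeff p i))

coeff-minusₚ : ∀ p q i → coeff (p -ₚ q) i ≡ coeff p i ℤ.- coeff q i
coeff-minusₚ p q i = trans (coeff-+ₚ p (negₚ q) i) (cong₂ ℤ._+_ (refl {x = coeff p i}) (coeff-negₚ q i))

convolution : (ℕ → ℤ) → (ℕ → ℤ) → ℕ → ℤ
convolution f g k = sum {suc k} λ j → f (toℕ j) ℤ.* g (k ∸ toℕ j)

convolution-cong : ∀ {f f' g g'} → f ≗ f' → g ≗ g' → convolution f g ≗ convolution f' g'
convolution-cong f≗f' g≗g' k = sum-cong-≗ {suc k} λ j → cong₂ ℤ._*_ (f≗f' (toℕ j)) (g≗g' (k ∸ toℕ j))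

convolution-congˡ : ∀ {f f'} g → f ≗ f' → convolution f g ≗ convolution f' g
convolution-congˡ g f≗f' = convolution-cong {g = g} f≗f' λ _ → refl

convolution-congʳ : ∀ f {g g'} → g ≗ g' → convolution f g ≗ convolution f g'
convolution-congʳ f = convolution-cong {f = f} λ _ → refl

convolution-zero : ∀ f g k → (∀ j → j ℕ.≤ k → f j ℤ.* g (k ∸ j) ≡ + 0) → convolution f g k ≡ + 0
convolution-zero f g k terms≡0 =
  trans (sum-cong-≗ {suc k} λ j → terms≡0 (toℕ j) (toℕ≤pred[n] j)) (sum-replicate-zero (suc k))

convolution-distribʳ : ∀ f g h → convolution (λ i → f i ℤ.+ g i) h ≗ λ k → convolution f h k ℤ.+ convolution g h k
convolution-distribʳ f g h k = trans
  (sum-cong-≗ {suc k} λ j → ℤP.*-distribʳ-+ (h (k ∸ toℕ j)) (f (toℕ j)) (g (toℕ j)))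
  (∑-distrib-+ {suc k} (λ j → f (toℕ j) ℤ.* h (k ∸ toℕ j)) (λ j → g (toℕ j) ℤ.* h (k ∸ toℕ j)))

convolution-distribˡ : ∀ f g h → convolution f (λ i → g i ℤ.+ h i) ≗ λ k → convolution f g k ℤ.+ convolution f h k
convolution-distribˡ f g h k = trans
  (sum-cong-≗ {suc k} λ j → ℤP.*-distribˡ-+ (f (toℕ j)) (g (k ∸ toℕ j)) (h (k ∸ toℕ j)))
  (∑-distrib-+ {suc k} (λ j → f (toℕ j) ℤ.* g (k ∸ toℕ j)) (λ j → f (toℕ j) ℤ.* h (k ∸ toℕ j)))

convolution-scaleˡ : ∀ c f g → convolution (λ i → c ℤ.* f i) g ≗ λ k → c ℤ.* convolution f g k
convolution-scaleˡ c f g k = trans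
  (sum-cong-≗ {suc k} λ j → ℤP.*-assoc c (f (toℕ j)) (g (k ∸ toℕ j)))
  (sym (*-distribˡ-sum {suc k} c λ j → f (toℕ j) ℤ.* g (k ∸ toℕ j)))

coeff-*ₚ : ∀ p q → coeff (p *ₚ q) ≗ convolution (coeff p) (coeff q)
coeff-*ₚ []      q k       = sym (convolution-zero (coeff []) (coeff q) k λ j _ → ℤP.*-zeroˡ (coeff q (k ∸ j)))
coeff-*ₚ (a ∷ p) q zero    = trans (coeff-+ₚ (scaleₚ a q) (+ 0 ∷ p *ₚ q) 0) (cong (ℤ._+ + 0) (coeff-scaleₚ a q 0))
coeff-*ₚ (a ∷ p) q (suc k) = trans (coeff-+ₚ (scaleₚ a q) (+ 0 ∷ p *ₚ q) (suc k))
  (cong₂ ℤ._+_ (coeff-scaleₚ a q (suc k)) (coeff-*ₚ p q k))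

∷-cong : ∀ {a p q} → p ≋ q → a ∷ p ≋ a ∷ q
∷-cong p≋q = coeffwise λ { zero → refl ; (suc i) → coeff-≡ p≋q i }

+ₚ-cong : ∀ {p p' q q'} → p ≋ p' → q ≋ q' → p +ₚ q ≋ p' +ₚ q'
+ₚ-cong {p} {p'} {q} {q'} p≋p' q≋q' = coeffwise λ i → trans (coeff-+ₚ p q i)
  (trans (cong₂ ℤ._+_ (coeff-≡ p≋p' i) (coeff-≡ q≋q' i)) (sym (coeff-+ₚ p' q' i)))

+ₚ-congˡ : ∀ p {q q'} → q ≋ q' → p +ₚ q ≋ p +ₚ q'
+ₚ-congˡ p q≋q' = +ₚ-cong (≋-refl {p}) q≋q'

+ₚ-congʳ : ∀ q {p p'} → p ≋ p' → p +ₚ q ≋ p' +ₚ q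
+ₚ-congʳ q p≋p' = +ₚ-cong p≋p' (≋-refl {q})

scaleₚ-cong : ∀ c {p q} → p ≋ q → scaleₚ c p ≋ scaleₚ c q
scaleₚ-cong c {p} {q} p≋q = coeffwise λ i → trans (coeff-scaleₚ c p i)
  (trans (cong (c ℤ.*_) (coeff-≡ p≋q i)) (sym (coeff-scaleₚ c q i)))

*ₚ-cong : ∀ {p p' q q'} → p ≋ p' → q ≋ q' → p *ₚ q ≋ p' *ₚ q'
*ₚ-cong {p} {p'} {q} {q'} p≋p' q≋q' = coeffwise λ k → trans (coeff-*ₚ p q k)
  (trans (convolution-cong (coeff-≡ p≋p') (coeff-≡ q≋q') k) (sym (coeff-*ₚ p' q' k)))

*ₚ-congˡ : ∀ p {q q'} → q ≋ q' → p *ₚ q ≋ p *ₚ q'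
*ₚ-congˡ p q≋q' = *ₚ-cong (≋-refl {p}) q≋q'

*ₚ-congʳ : ∀ q {p p'} → p ≋ p' → p *ₚ q ≋ p' *ₚ q
*ₚ-congʳ q p≋p' = *ₚ-cong p≋p' (≋-refl {q})

+ₚ-comm : ∀ p q → p +ₚ q ≋ q +ₚ p
+ₚ-comm p q = coeffwise λ i → trans (coeff-+ₚ p q i)
  (trans (ℤP.+-comm (coeff p i) (coeff q i)) (sym (coeff-+ₚ q p i)))

+ₚ-assoc : ∀ p q s → (p +ₚ q) +ₚ s ≋ p +ₚ (q +ₚ s)
+ₚ-assoc p q s = coeffwise λ i → begin
  coeff ((p +ₚ q) +ₚ s) i                   ≡⟨ coeff-+ₚ (p +ₚ q) s i ⟩
  coeff (p +ₚ q) i ℤ.+ coeff s i            ≡⟨ cong (ℤ._+ coeff s i) (coeff-+ₚ p q i) ⟩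
  (coeff p i ℤ.+ coeff q i) ℤ.+ coeff s i   ≡⟨ ℤP.+-assoc (coeff p i) (coeff q i) (coeff s i) ⟩
  coeff p i ℤ.+ (coeff q i ℤ.+ coeff s i)   ≡⟨ cong₂ ℤ._+_ (refl {x = coeff p i}) (coeff-+ₚ q s i) ⟨
  coeff p i ℤ.+ coeff (q +ₚ s) i            ≡⟨ coeff-+ₚ p (q +ₚ s) i ⟨
  coeff (p +ₚ (q +ₚ s)) i                   ∎
  where open ≡-Reasoning

+ₚ-identityʳ : ∀ p → p +ₚ [] ≋ p
+ₚ-identityʳ p = coeffwise λ i → trans (coeff-+ₚ p [] i) (ℤP.+-identityʳ _)

*ₚ-distribʳ-+ₚ : ∀ p q s → (p +ₚ q) *ₚ s ≋ p *ₚ s +ₚ q *ₚ s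
*ₚ-distribʳ-+ₚ p q s = coeffwise λ k → begin
  coeff ((p +ₚ q) *ₚ s) k                                              ≡⟨ coeff-*ₚ (p +ₚ q) s k ⟩
  convolution (coeff (p +ₚ q)) (coeff s) k                             ≡⟨ convolution-congˡ (coeff s) (coeff-+ₚ p q) k ⟩
  convolution (λ i → coeff p i ℤ.+ coeff q i) (coeff s) k              ≡⟨ convolution-distribʳ (coeff p) (coeff q) (coeff s) k ⟩
  convolution (coeff p) (coeff s) k ℤ.+ convolution (coeff q) (coeff s) k ≡⟨ cong₂ ℤ._+_ (coeff-*ₚ p s k) (coeff-*ₚ q s k) ⟨
  coeff (p *ₚ s) k ℤ.+ coeff (q *ₚ s) k                                ≡⟨ coeff-+ₚ (p *ₚ s) (q *ₚ s) k ⟨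
  coeff (p *ₚ s +ₚ q *ₚ s) k                                           ∎
  where open ≡-Reasoning

*ₚ-distribˡ-+ₚ : ∀ s p q → s *ₚ (p +ₚ q) ≋ s *ₚ p +ₚ s *ₚ q
*ₚ-distribˡ-+ₚ s p q = coeffwise λ k → begin
  coeff (s *ₚ (p +ₚ q)) k                                              ≡⟨ coeff-*ₚ s (p +ₚ q) k ⟩
  convolution (coeff s) (coeff (p +ₚ q)) k                             ≡⟨ convolution-congʳ (coeff s) (coeff-+ₚ p q) k ⟩
  convolution (coeff s) (λ i → coeff p i ℤ.+ coeff q i) k              ≡⟨ convolution-distribˡ (coeff s) (coeff p) (coeff q) k ⟩
  convolution (coeff s) (coeff p) k ℤ.+ convolution (coeff s) (coeff q) k ≡⟨ cong₂ ℤ._+_ (coeff-*ₚ s p k) (coeff-*ₚ s q k) ⟨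
  coeff (s *ₚ p) k ℤ.+ coeff (s *ₚ q) k                                ≡⟨ coeff-+ₚ (s *ₚ p) (s *ₚ q) k ⟨
  coeff (s *ₚ p +ₚ s *ₚ q) k                                           ∎
  where open ≡-Reasoning

scaleₚ-*ₚ : ∀ c p q → scaleₚ c p *ₚ q ≋ scaleₚ c (p *ₚ q)
scaleₚ-*ₚ c p q = coeffwise λ k → begin
  coeff (scaleₚ c p *ₚ q) k                             ≡⟨ coeff-*ₚ (scaleₚ c p) q k ⟩
  convolution (coeff (scaleₚ c p)) (coeff q) k          ≡⟨ convolution-congˡ (coeff q) (coeff-scaleₚ c p) k ⟩
  convolution (λ i → c ℤ.* coeff p i) (coeff q) k       ≡⟨ convolution-scaleˡ c (coeff p) (coeff q) k ⟩
  c ℤ.* convolution (coeff p) (coeff q) k               ≡⟨ cong (c ℤ.*_) (coeff-*ₚ p q k) ⟨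
  c ℤ.* coeff (p *ₚ q) k                                ≡⟨ coeff-scaleₚ c (p *ₚ q) k ⟨
  coeff (scaleₚ c (p *ₚ q)) k                           ∎
  where open ≡-Reasoning

0∷-*ₚ : ∀ p q → (+ 0 ∷ p) *ₚ q ≋ + 0 ∷ p *ₚ q
0∷-*ₚ p q = coeffwise λ i → trans (coeff-+ₚ (scaleₚ (+ 0) q) (+ 0 ∷ p *ₚ q) i)
  (trans (cong (ℤ._+ coeff (+ 0 ∷ p *ₚ q) i) (trans (coeff-scaleₚ (+ 0) q i) (ℤP.*-zeroˡ (coeff q i))))
         (ℤP.+-identityˡ _))

*ₚ-assoc : ∀ p q s → (p *ₚ q) *ₚ s ≋ p *ₚ (q *ₚ s)
*ₚ-assoc []      q s = ≋-refl
*ₚ-assoc (c ∷ p) q s = ≋-trans (*ₚ-distribʳ-+ₚ (scaleₚ c q) (+ 0 ∷ p *ₚ q) s)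
  (+ₚ-cong (scaleₚ-*ₚ c q s) (≋-trans (0∷-*ₚ (p *ₚ q) s) (∷-cong (*ₚ-assoc p q s))))

*ₚ-zeroʳ : ∀ p → p *ₚ [] ≋ []
*ₚ-zeroʳ []      = ≋-refl
*ₚ-zeroʳ (a ∷ p) = coeffwise λ { zero → refl ; (suc i) → coeff-≡ (*ₚ-zeroʳ p) i }

*ₚ-identityʳ : ∀ p → p *ₚ 1ₚ ≋ p
*ₚ-identityʳ []      = ≋-refl
*ₚ-identityʳ (c ∷ p) = coeffwise λ
  { zero    → trans (coeff-+ₚ (scaleₚ c 1ₚ) (+ 0 ∷ p *ₚ 1ₚ) 0) (trans (ℤP.+-identityʳ _) (ℤP.*-identityʳ c))
  ; (suc i) → trans (coeff-+ₚ (scaleₚ c 1ₚ) (+ 0 ∷ p *ₚ 1ₚ) (suc i))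
                    (trans (ℤP.+-identityˡ _) (coeff-≡ (*ₚ-identityʳ p) i)) }

const-*ₚ : ∀ c q → (c ∷ []) *ₚ q ≋ scaleₚ c q
const-*ₚ c q = coeffwise λ i → trans (coeff-+ₚ (scaleₚ c q) (+ 0 ∷ []) i)
  (trans (cong₂ ℤ._+_ (refl {x = coeff (scaleₚ c q) i}) (zero-coeff i)) (ℤP.+-identityʳ _))
  where
  zero-coeff : ∀ i → coeff (+ 0 ∷ []) i ≡ + 0
  zero-coeff zero    = refl
  zero-coeff (suc i) = refl

+ₚ-inverseˡ : ∀ p → negₚ p +ₚ p ≋ []
+ₚ-inverseˡ p = coeffwise λ i → trans (coeff-+ₚ (negₚ p) p i)
  (trans (cong (ℤ._+ coeff p i) (coeff-negₚ p i)) (ℤP.+-inverseˡ (coeff p i)))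

+ₚ-abelianGroup : AbelianGroup _ _
+ₚ-abelianGroup = record
  { Carrier = Poly ; _≈_ = _≋_ ; _∙_ = _+ₚ_ ; ε = [] ; _⁻¹ = negₚ
  ; isAbelianGroup = record
    { isGroup = record
      { isMonoid = record
        { isSemigroup = record
          { isMagma = record { isEquivalence = Setoid.isEquivalence ≋-setoid ; ∙-cong = +ₚ-cong }
          ; assoc = +ₚ-assoc }
        ; identity = (λ _ → ≋-refl) , +ₚ-identityʳ }
      ; inverse = +ₚ-inverseˡ , (λ p → ≋-trans (+ₚ-comm p (negₚ p)) (+ₚ-inverseˡ p))
      ; ⁻¹-cong = scaleₚ-cong (- + 1) }
    ; comm = +ₚ-comm } }

open import Algebra.Properties.AbelianGroup +ₚ-abelianGroup
  using (∙-cancelʳ; identityʳ-unique; //-rightDividesˡ; x∙y⁻¹≈ε⇒x≈y)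
open import Algebra.Properties.CommutativeSemigroup (AbelianGroup.commutativeSemigroup +ₚ-abelianGroup)
  using (interchange; x∙yz≈y∙xz; xy∙z≈xz∙y; xy∙z≈yz∙x)

-- Reversal

coeff-map-applyUpTo-< : ∀ (f : ℕ → ℤ) g n i → i ℕ.< n → coeff (map f (applyUpTo g n)) i ≡ f (g i)
coeff-map-applyUpTo-< f g (suc n) zero    _         = refl
coeff-map-applyUpTo-< f g (suc n) (suc i) (s≤s i<n) = coeff-map-applyUpTo-< f (g ∘ suc) n i i<n

coeff-map-applyUpTo-≥ : ∀ (f : ℕ → ℤ) g n i → n ℕ.≤ i → coeff (map f (applyUpTo g n)) i ≡ + 0
coeff-map-applyUpTo-≥ f g zero    i       _         = refl
coeff-map-applyUpTo-≥ f g (suc n) (suc i) (s≤s n≤i) = coeff-map-applyUpTo-≥ f (g ∘ suc) n i n≤i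

coeff-revₚ-≤ : ∀ r p {i} → i ℕ.≤ r → coeff (revₚ r p) i ≡ coeff p (r ∸ i)
coeff-revₚ-≤ r p {i} i≤r = coeff-map-applyUpTo-< (λ i → coeff p (r ∸ i)) (λ i → i) (suc r) i (s≤s i≤r)

coeff-revₚ-> : ∀ r p {i} → r ℕ.< i → coeff (revₚ r p) i ≡ + 0
coeff-revₚ-> r p {i} r<i = coeff-map-applyUpTo-≥ (λ i → coeff p (r ∸ i)) (λ i → i) (suc r) i r<i

DegLe-revₚ : ∀ r p → DegLe (revₚ r p) r
DegLe-revₚ r p i r<i = coeff-revₚ-> r p r<i

DegLe-mono : ∀ p {m n} → m ℕ.≤ n → DegLe p m → DegLe p n
DegLe-mono p m≤n deg i n<i = deg i (ℕP.≤-<-trans m≤n n<i)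

DegLe-+ₚ : ∀ p q {n} → DegLe p n → DegLe q n → DegLe (p +ₚ q) n
DegLe-+ₚ p q degp degq i n<i =
  trans (coeff-+ₚ p q i) (cong₂ ℤ._+_ (degp i n<i) (degq i n<i))

DegLe-scaleₚ : ∀ c p {n} → DegLe p n → DegLe (scaleₚ c p) n
DegLe-scaleₚ c p deg i n<i =
  trans (coeff-scaleₚ c p i) (trans (cong (c ℤ.*_) (deg i n<i)) (ℤP.*-zeroʳ c))

revₚ-≋ : ∀ r p q → (∀ i → i ℕ.≤ r → coeff p (r ∸ i) ≡ coeff q i) → DegLe q r → revₚ r p ≋ q
revₚ-≋ r p q low high = coeffwise λ i → case-≤ i (i ℕ.≤? r)
  where
  case-≤ : ∀ i → Dec (i ℕ.≤ r) → coeff (revₚ r p) i ≡ coeff q i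
  case-≤ i (yes i≤r) = trans (coeff-revₚ-≤ r p i≤r) (low i i≤r)
  case-≤ i (no  i≰r) = trans (coeff-revₚ-> r p (ℕP.≰⇒> i≰r)) (sym (high i (ℕP.≰⇒> i≰r)))

revₚ-cong : ∀ r {p q} → p ≋ q → revₚ r p ≋ revₚ r q
revₚ-cong r {p} {q} p≋q = revₚ-≋ r p (revₚ r q) (λ i i≤r → trans (coeff-≡ p≋q (r ∸ i)) (sym (coeff-revₚ-≤ r q i≤r)))
  (DegLe-revₚ r q)

revₚ-zero : ∀ r → revₚ r [] ≋ []
revₚ-zero r = revₚ-≋ r [] [] (λ _ _ → refl) (λ _ _ → refl)

revₚ-+ₚ : ∀ r p q → revₚ r (p +ₚ q) ≋ revₚ r p +ₚ revₚ r q
revₚ-+ₚ r p q = revₚ-≋ r (p +ₚ q) (revₚ r p +ₚ revₚ r q)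
  (λ i i≤r → trans (coeff-+ₚ p q (r ∸ i)) (trans
    (sym (cong₂ ℤ._+_ (coeff-revₚ-≤ r p i≤r) (coeff-revₚ-≤ r q i≤r))) (sym (coeff-+ₚ (revₚ r p) (revₚ r q) i))))
  (DegLe-+ₚ (revₚ r p) (revₚ r q) (DegLe-revₚ r p) (DegLe-revₚ r q))

revₚ-scaleₚ : ∀ r c p → revₚ r (scaleₚ c p) ≋ scaleₚ c (revₚ r p)
revₚ-scaleₚ r c p = revₚ-≋ r (scaleₚ c p) (scaleₚ c (revₚ r p))
  (λ i i≤r → trans (coeff-scaleₚ c p (r ∸ i)) (trans
    (cong (c ℤ.*_) (sym (coeff-revₚ-≤ r p i≤r))) (sym (coeff-scaleₚ c (revₚ r p) i))))
  (DegLe-scaleₚ c (revₚ r p) (DegLe-revₚ r p))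

shiftₚ : ℕ → Poly → Poly
shiftₚ zero    p = p
shiftₚ (suc n) p = + 0 ∷ shiftₚ n p

shiftₚ-*ₚ : ∀ n p q → shiftₚ n p *ₚ q ≋ shiftₚ n (p *ₚ q)
shiftₚ-*ₚ zero    p q = ≋-refl
shiftₚ-*ₚ (suc n) p q = ≋-trans (0∷-*ₚ (shiftₚ n p) q) (∷-cong (shiftₚ-*ₚ n p q))

shiftₚ-cong : ∀ n {p q} → p ≋ q → shiftₚ n p ≋ shiftₚ n q
shiftₚ-cong zero    p≋q = p≋q
shiftₚ-cong (suc n) p≋q = ∷-cong (shiftₚ-cong n p≋q)

shiftₚ-scaleₚ : ∀ n c p → shiftₚ n (scaleₚ c p) ≋ scaleₚ c (shiftₚ n p)
shiftₚ-scaleₚ zero    c p = ≋-refl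
shiftₚ-scaleₚ (suc n) c p = ≋-trans (∷-cong (shiftₚ-scaleₚ n c p))
  (coeffwise λ { zero → sym (ℤP.*-zeroʳ c) ; (suc i) → refl })

revₚ-suc-0∷ : ∀ n p → revₚ (suc n) (+ 0 ∷ p) ≋ revₚ n p
revₚ-suc-0∷ n p = revₚ-≋ (suc n) (+ 0 ∷ p) (revₚ n p) low
  (DegLe-mono (revₚ n p) (ℕP.n≤1+n n) (DegLe-revₚ n p))
  where
  low : ∀ i → i ℕ.≤ suc n → coeff (+ 0 ∷ p) (suc n ∸ i) ≡ coeff (revₚ n p) i
  low i i≤1+n with i ℕ.≤? n
  ... | yes i≤n = trans (cong (coeff (+ 0 ∷ p)) (ℕP.+-∸-assoc 1 i≤n)) (sym (coeff-revₚ-≤ n p i≤n))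
  ... | no  i≰n = trans (cong (coeff (+ 0 ∷ p)) (ℕP.m≤n⇒m∸n≡0 (ℕP.≰⇒> i≰n)))
                        (sym (coeff-revₚ-> n p (ℕP.≰⇒> i≰n)))

revₚ-suc : ∀ m q → DegLe q m → revₚ (suc m) q ≋ + 0 ∷ revₚ m q
revₚ-suc m q deg = revₚ-≋ (suc m) q (+ 0 ∷ revₚ m q) low high
  where
  low : ∀ i → i ℕ.≤ suc m → coeff q (suc m ∸ i) ≡ coeff (+ 0 ∷ revₚ m q) i
  low zero    _           = deg (suc m) (ℕP.n<1+n m)
  low (suc i) (s≤s i≤m)   = sym (coeff-revₚ-≤ m q i≤m)
  high : DegLe (+ 0 ∷ revₚ m q) (suc m)
  high (suc i) (s≤s m<i) = coeff-revₚ-> m q m<i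

revₚ-+-shiftₚ : ∀ n m q → DegLe q m → revₚ (n ℕ.+ m) q ≋ shiftₚ n (revₚ m q)
revₚ-+-shiftₚ zero    m q deg = ≋-refl
revₚ-+-shiftₚ (suc n) m q deg =
  ≋-trans (revₚ-suc (n ℕ.+ m) q (DegLe-mono q (ℕP.m≤n+m m n) deg)) (∷-cong (revₚ-+-shiftₚ n m q deg))

revₚ-suc-∷ : ∀ a c p → revₚ (suc a) (c ∷ p) ≋ shiftₚ (suc a) (c ∷ []) +ₚ revₚ a p
revₚ-suc-∷ a c p = begin
  revₚ (suc a) (c ∷ p)                                  ≈⟨ revₚ-cong (suc a) split ⟩
  revₚ (suc a) ((c ∷ []) +ₚ (+ 0 ∷ p))                  ≈⟨ revₚ-+ₚ (suc a) (c ∷ []) (+ 0 ∷ p) ⟩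
  revₚ (suc a) (c ∷ []) +ₚ revₚ (suc a) (+ 0 ∷ p)       ≈⟨ +ₚ-cong constant (revₚ-suc-0∷ a p) ⟩
  shiftₚ (suc a) (c ∷ []) +ₚ revₚ a p                   ∎
  where
  open ≋-Reasoning
  split : c ∷ p ≋ (c ∷ []) +ₚ (+ 0 ∷ p)
  split = coeffwise λ { zero → sym (ℤP.+-identityʳ c) ; (suc i) → refl }
  constant : revₚ (suc a) (c ∷ []) ≋ shiftₚ (suc a) (c ∷ [])
  constant = subst (λ n → revₚ n (c ∷ []) ≋ shiftₚ (suc a) (c ∷ [])) (ℕP.+-identityʳ (suc a))
    (revₚ-+-shiftₚ (suc a) 0 (c ∷ []) λ { (suc i) _ → refl })

scaleₚ-shiftₚ : ∀ n c p → scaleₚ c (shiftₚ n p) ≋ shiftₚ n (c ∷ []) *ₚ p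
scaleₚ-shiftₚ n c p = ≋-sym (≋-trans (shiftₚ-*ₚ n (c ∷ []) p)
  (≋-trans (shiftₚ-cong n (const-*ₚ c p)) (shiftₚ-scaleₚ n c p)))

revₚ-*ₚ : ∀ a b p q → DegLe p a → DegLe q b → revₚ (a ℕ.+ b) (p *ₚ q) ≋ revₚ a p *ₚ revₚ b q
revₚ-*ₚ a b [] q _ _ = ≋-trans (revₚ-zero (a ℕ.+ b)) (≋-sym (*ₚ-congʳ (revₚ b q) (revₚ-zero a)))
revₚ-*ₚ zero b (c ∷ p) q degp degq = begin
  revₚ b (scaleₚ c q +ₚ (+ 0 ∷ p *ₚ q))   ≈⟨ revₚ-cong b (≋-trans (+ₚ-congˡ (scaleₚ c q) 0∷p*q≋0) (+ₚ-identityʳ (scaleₚ c q))) ⟩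
  revₚ b (scaleₚ c q)                     ≈⟨ revₚ-scaleₚ b c q ⟩
  scaleₚ c (revₚ b q)                     ≈⟨ const-*ₚ c (revₚ b q) ⟨
  (c ∷ []) *ₚ revₚ b q                    ∎
  where
  open ≋-Reasoning
  p≋0 : p ≋ []
  p≋0 = coeffwise λ j → degp (suc j) (s≤s z≤n)
  0∷p*q≋0 : + 0 ∷ p *ₚ q ≋ []
  0∷p*q≋0 = coeffwise λ
    { zero    → refl
    ; (suc i) → coeff-≡ (*ₚ-congʳ q p≋0) i }
revₚ-*ₚ (suc a) b (c ∷ p) q degp degq = begin
  revₚ (suc (a ℕ.+ b)) (scaleₚ c q +ₚ (+ 0 ∷ p *ₚ q))
    ≈⟨ revₚ-+ₚ (suc (a ℕ.+ b)) (scaleₚ c q) (+ 0 ∷ p *ₚ q) ⟩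
  revₚ (suc a ℕ.+ b) (scaleₚ c q) +ₚ revₚ (suc (a ℕ.+ b)) (+ 0 ∷ p *ₚ q)
    ≈⟨ +ₚ-cong (revₚ-scaleₚ (suc a ℕ.+ b) c q) (revₚ-suc-0∷ (a ℕ.+ b) (p *ₚ q)) ⟩
  scaleₚ c (revₚ (suc a ℕ.+ b) q) +ₚ revₚ (a ℕ.+ b) (p *ₚ q)
    ≈⟨ +ₚ-cong (scaleₚ-cong c (revₚ-+-shiftₚ (suc a) b q degq)) (revₚ-*ₚ a b p q (λ i a<i → degp (suc i) (s≤s a<i)) degq) ⟩
  scaleₚ c (shiftₚ (suc a) (revₚ b q)) +ₚ revₚ a p *ₚ revₚ b q
    ≈⟨ +ₚ-congʳ (revₚ a p *ₚ revₚ b q) (scaleₚ-shiftₚ (suc a) c (revₚ b q)) ⟩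
  shiftₚ (suc a) (c ∷ []) *ₚ revₚ b q +ₚ revₚ a p *ₚ revₚ b q
    ≈⟨ *ₚ-distribʳ-+ₚ (shiftₚ (suc a) (c ∷ [])) (revₚ a p) (revₚ b q) ⟨
  (shiftₚ (suc a) (c ∷ []) +ₚ revₚ a p) *ₚ revₚ b q
    ≈⟨ *ₚ-congʳ (revₚ b q) (revₚ-suc-∷ a c p) ⟨
  revₚ (suc a) (c ∷ p) *ₚ revₚ b q
    ∎
  where open ≋-Reasoning

-- The factor t - 1 and Δ

coeff-t-1*ₚ-zero : ∀ p → coeff (t-1 *ₚ p) 0 ≡ - coeff p 0
coeff-t-1*ₚ-zero p = trans (coeff-+ₚ (negₚ p) (+ 0 ∷ (+ 1 ∷ []) *ₚ p) 0)
  (trans (ℤP.+-identityʳ _) (coeff-negₚ p 0))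

coeff-t-1*ₚ-suc : ∀ p i → coeff (t-1 *ₚ p) (suc i) ≡ coeff p i ℤ.- coeff p (suc i)
coeff-t-1*ₚ-suc p i = begin
  coeff (t-1 *ₚ p) (suc i)
    ≡⟨ coeff-+ₚ (negₚ p) (+ 0 ∷ (+ 1 ∷ []) *ₚ p) (suc i) ⟩
  coeff (negₚ p) (suc i) ℤ.+ coeff ((+ 1 ∷ []) *ₚ p) i
    ≡⟨ cong₂ ℤ._+_ (coeff-negₚ p (suc i)) (trans (coeff-≡ (const-*ₚ (+ 1) p) i)
                                              (trans (coeff-scaleₚ (+ 1) p i) (ℤP.*-identityˡ _))) ⟩
  - coeff p (suc i) ℤ.+ coeff p i
    ≡⟨ ℤP.+-comm (- coeff p (suc i)) (coeff p i) ⟩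
  coeff p i ℤ.- coeff p (suc i)
    ∎
  where open ≡-Reasoning

t-1*ₚ≋0⇒≋0 : ∀ p → t-1 *ₚ p ≋ [] → p ≋ []
t-1*ₚ≋0⇒≋0 p t-1*p≋0 = coeffwise coeff≡0
  where
  coeff≡0 : ∀ i → coeff p i ≡ + 0
  coeff≡0 zero    = trans (sym (ℤP.neg-involutive _))
    (cong -_ (trans (sym (coeff-t-1*ₚ-zero p)) (coeff-≡ t-1*p≋0 0)))
  coeff≡0 (suc i) = trans (sym (ℤP.i-j≡0⇒i≡j (coeff p i) (coeff p (suc i))
    (trans (sym (coeff-t-1*ₚ-suc p i)) (coeff-≡ t-1*p≋0 (suc i))))) (coeff≡0 i)

coeff-map-zero : ∀ {A : Set} (f : A → ℤ) l i → (∀ a → f a ≡ + 0) → coeff (map f l) i ≡ + 0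
coeff-map-zero f []      i       f≡0 = refl
coeff-map-zero f (a ∷ l) zero    f≡0 = f≡0 a
coeff-map-zero f (a ∷ l) (suc i) f≡0 = coeff-map-zero f l i f≡0

DegLtHalf⇒DegLe : ∀ p r → DegLtHalf p r → DegLe p r
DegLtHalf⇒DegLe p r deg i r<i = deg i (ℕP.≤-trans (ℕP.<⇒≤ r<i) (ℕP.m≤m+n i (i ℕ.+ 0)))

DegLtHalf-minusₚ : ∀ p q r → DegLtHalf p r → DegLtHalf q r → DegLtHalf (p -ₚ q) r
DegLtHalf-minusₚ p q r degp degq i r≤2i =
  trans (coeff-minusₚ p q i) (cong₂ ℤ._-_ (degp i r≤2i) (degq i r≤2i))

DegLtHalf-*ₚ : ∀ p q a b → DegLtHalf p a → DegLtHalf q b → DegLtHalf (p *ₚ q) (a ℕ.+ b)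
DegLtHalf-*ₚ p q a b degp degq k a+b≤2k =
  trans (coeff-*ₚ p q k) (convolution-zero (coeff p) (coeff q) k term≡0)
  where
  term≡0 : ∀ j → j ℕ.≤ k → coeff p j ℤ.* coeff q (k ∸ j) ≡ + 0
  term≡0 j j≤k with a ℕ.≤? 2 ℕ.* j
  ... | yes a≤2j = trans (cong (ℤ._* coeff q (k ∸ j)) (degp j a≤2j)) (ℤP.*-zeroˡ (coeff q (k ∸ j)))
  ... | no  a≰2j = trans (cong (coeff p j ℤ.*_) (degq (k ∸ j) b≤2[k∸j])) (ℤP.*-zeroʳ (coeff p j))
    where
    b≤2[k∸j] : b ℕ.≤ 2 ℕ.* (k ∸ j)
    b≤2[k∸j] = ℕP.≮⇒≥ λ 2[k∸j]<b → ℕP.<⇒≱ (ℕP.+-mono-< (ℕP.≰⇒> a≰2j) 2[k∸j]<b) (begin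
      a ℕ.+ b                          ≤⟨ a+b≤2k ⟩
      2 ℕ.* k                          ≡⟨ cong (2 ℕ.*_) (ℕP.m+[n∸m]≡n j≤k) ⟨
      2 ℕ.* (j ℕ.+ (k ∸ j))            ≡⟨ ℕP.*-distribˡ-+ 2 j (k ∸ j) ⟩
      2 ℕ.* j ℕ.+ 2 ℕ.* (k ∸ j)        ∎)
      where open ℕP.≤-Reasoning

-- Δ B r p z z' reduces to Δₚ (r z z') (p z z') whenever z ≢ z'.
Δₚ : ℕ → Poly → Poly
Δₚ r p = coeff p 0 ∷ map (λ j → coeff p (suc j) ℤ.- coeff p j) (upTo ((r ∸ 1) / 2))

j<[r∸1]/2⇒2[1+j]<r : ∀ r j → j ℕ.< (r ∸ 1) / 2 → 2 ℕ.* suc j ℕ.< r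
j<[r∸1]/2⇒2[1+j]<r (suc r) j j<r/2 = s≤s (subst (ℕ._≤ r) (ℕP.*-comm (suc j) 2)
  (ℕP.≤-trans (ℕP.*-monoˡ-≤ 2 j<r/2) (ℕD.m/n*n≤m r 2)))

2[1+j]<r⇒j<[r∸1]/2 : ∀ r j → 2 ℕ.* suc j ℕ.< r → j ℕ.< (r ∸ 1) / 2
2[1+j]<r⇒j<[r∸1]/2 (suc r) j (s≤s 2[1+j]≤r) = subst (ℕ._≤ r / 2) (ℕD.m*n/n≡m (suc j) 2)
  (ℕD./-monoˡ-≤ 2 (subst (ℕ._≤ r) (ℕP.*-comm 2 (suc j)) 2[1+j]≤r))

2i<r⇒r≤2[r∸i] : ∀ r i → 2 ℕ.* i ℕ.< r → r ℕ.≤ 2 ℕ.* (r ∸ i)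
2i<r⇒r≤2[r∸i] r i 2i<r = begin
  r                      ≡⟨ ℕP.m+[n∸m]≡n i≤r ⟨
  i ℕ.+ (r ∸ i)          ≤⟨ ℕP.+-monoˡ-≤ (r ∸ i) (ℕP.<⇒≤ i<r∸i) ⟩
  (r ∸ i) ℕ.+ (r ∸ i)    ≡⟨ cong ((r ∸ i) ℕ.+_) (ℕP.+-identityʳ (r ∸ i)) ⟨
  2 ℕ.* (r ∸ i)          ∎
  where
  open ℕP.≤-Reasoning
  i≤r : i ℕ.≤ r
  i≤r = ℕP.≤-trans (ℕP.m≤m+n i (i ℕ.+ 0)) (ℕP.<⇒≤ 2i<r)
  i<r∸i : i ℕ.< r ∸ i
  i<r∸i = ℕP.+-cancelˡ-< i i (r ∸ i)
    (subst₂ ℕ._<_ (cong (i ℕ.+_) (ℕP.+-identityʳ i)) (sym (ℕP.m+[n∸m]≡n i≤r)) 2i<r)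

DegLtHalf-Δₚ : ∀ r p → 1 ℕ.≤ r → DegLtHalf (Δₚ r p) r
DegLtHalf-Δₚ r p 1≤r zero    r≤0         = ⊥-elim (ℕP.<⇒≱ 1≤r r≤0)
DegLtHalf-Δₚ r p 1≤r (suc j) r≤2[1+j] = coeff-map-applyUpTo-≥ _ (λ j → j) ((r ∸ 1) / 2) j
  (ℕP.≮⇒≥ λ j<r/2 → ℕP.<⇒≱ (j<[r∸1]/2⇒2[1+j]<r r j j<r/2) r≤2[1+j])

Δₚ-zero : ∀ r {p} → p ≋ [] → Δₚ r p ≋ []
Δₚ-zero r {p} p≋0 = coeffwise λ
  { zero    → coeff-≡ p≋0 0
  ; (suc i) → coeff-map-zero _ (upTo ((r ∸ 1) / 2)) i
                λ j → cong₂ ℤ._-_ (coeff-≡ p≋0 (suc j)) (coeff-≡ p≋0 j) }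

-- Below degree r/2 the reversal of v vanishes, so v is read off from (t - 1) p there.
Δₚ-unique : ∀ r p v → 1 ℕ.≤ r → DegLtHalf v r → revₚ r v ≋ v +ₚ t-1 *ₚ p → v ≋ Δₚ r p
Δₚ-unique r p v 1≤r deg rev≋ = coeffwise coeff-v
  where
  below-half : ∀ i → 2 ℕ.* i ℕ.< r → coeff v i ≡ - coeff (t-1 *ₚ p) i
  below-half i 2i<r = inverseˡ-unique (coeff v i) (coeff (t-1 *ₚ p) i) (begin
    coeff v i ℤ.+ coeff (t-1 *ₚ p) i   ≡⟨ coeff-+ₚ v (t-1 *ₚ p) i ⟨
    coeff (v +ₚ t-1 *ₚ p) i            ≡⟨ coeff-≡ rev≋ i ⟨
    coeff (revₚ r v) i                 ≡⟨ coeff-revₚ-≤ r v (ℕP.≤-trans (ℕP.m≤m+n i (i ℕ.+ 0)) (ℕP.<⇒≤ 2i<r)) ⟩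
    coeff v (r ∸ i)                    ≡⟨ deg (r ∸ i) (2i<r⇒r≤2[r∸i] r i 2i<r) ⟩
    + 0                                ∎)
    where open ≡-Reasoning
  coeff-v : ∀ i → coeff v i ≡ coeff (Δₚ r p) i
  coeff-v zero = trans (below-half 0 1≤r) (trans (cong -_ (coeff-t-1*ₚ-zero p)) (ℤP.neg-involutive _))
  coeff-v (suc j) with 2 ℕ.* suc j ℕ.<? r
  ... | yes 2[1+j]<r = begin
    coeff v (suc j)                          ≡⟨ below-half (suc j) 2[1+j]<r ⟩
    - coeff (t-1 *ₚ p) (suc j)               ≡⟨ cong -_ (coeff-t-1*ₚ-suc p j) ⟩
    - (coeff p j ℤ.- coeff p (suc j))        ≡⟨ ⁻¹-anti-homo‿- (coeff p j) (coeff p (suc j)) ⟩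
    coeff p (suc j) ℤ.- coeff p j            ≡⟨ coeff-map-applyUpTo-< _ (λ j → j) ((r ∸ 1) / 2) j (2[1+j]<r⇒j<[r∸1]/2 r j 2[1+j]<r) ⟨
    coeff (Δₚ r p) (suc j)                   ∎
    where open ≡-Reasoning
  ... | no 2[1+j]≮r = trans (deg (suc j) (ℕP.≮⇒≥ 2[1+j]≮r))
    (sym (coeff-map-applyUpTo-≥ _ (λ j → j) ((r ∸ 1) / 2) j (ℕP.≮⇒≥ (2[1+j]≮r ∘ j<[r∸1]/2⇒2[1+j]<r r j))))

-- Finite sums

Σ : ∀ {A : Set} → (A → Poly) → List A → Poly
Σ F l = sumₚ (map F l)

module _ {A : Set} where

  Σ-cong : ∀ {F G : A → Poly} l → (∀ {a} → a ∈ l → F a ≋ G a) → Σ F l ≋ Σ G l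
  Σ-cong []      F≋G = ≋-refl
  Σ-cong (a ∷ l) F≋G = +ₚ-cong (F≋G (here refl)) (Σ-cong l (F≋G ∘ there))

  Σ-zero : ∀ {F : A → Poly} l → (∀ {a} → a ∈ l → F a ≋ []) → Σ F l ≋ []
  Σ-zero []      F≋0 = ≋-refl
  Σ-zero (a ∷ l) F≋0 = +ₚ-cong (F≋0 (here refl)) (Σ-zero l (F≋0 ∘ there))

  Σ-+ₚ : ∀ (F G : A → Poly) l → Σ (λ a → F a +ₚ G a) l ≋ Σ F l +ₚ Σ G l
  Σ-+ₚ F G []      = ≋-refl
  Σ-+ₚ F G (a ∷ l) = ≋-trans (+ₚ-congˡ (F a +ₚ G a) (Σ-+ₚ F G l)) (interchange (F a) (G a) (Σ F l) (Σ G l))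

  *ₚ-distribˡ-Σ : ∀ p (F : A → Poly) l → p *ₚ Σ F l ≋ Σ (λ a → p *ₚ F a) l
  *ₚ-distribˡ-Σ p F []      = *ₚ-zeroʳ p
  *ₚ-distribˡ-Σ p F (a ∷ l) = ≋-trans (*ₚ-distribˡ-+ₚ p (F a) (Σ F l)) (+ₚ-congˡ (p *ₚ F a) (*ₚ-distribˡ-Σ p F l))

  *ₚ-distribʳ-Σ : ∀ p (F : A → Poly) l → Σ F l *ₚ p ≋ Σ (λ a → F a *ₚ p) l
  *ₚ-distribʳ-Σ p F []      = ≋-refl
  *ₚ-distribʳ-Σ p F (a ∷ l) = ≋-trans (*ₚ-distribʳ-+ₚ (F a) (Σ F l) p) (+ₚ-congˡ (F a *ₚ p) (*ₚ-distribʳ-Σ p F l))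

  revₚ-Σ : ∀ r (F : A → Poly) l → revₚ r (Σ F l) ≋ Σ (λ a → revₚ r (F a)) l
  revₚ-Σ r F []      = revₚ-zero r
  revₚ-Σ r F (a ∷ l) = ≋-trans (revₚ-+ₚ r (F a) (Σ F l)) (+ₚ-congˡ (revₚ r (F a)) (revₚ-Σ r F l))

  DegLtHalf-Σ : ∀ (F : A → Poly) l r → (∀ {a} → a ∈ l → DegLtHalf (F a) r) → DegLtHalf (Σ F l) r
  DegLtHalf-Σ F []      r deg i r≤2i = refl
  DegLtHalf-Σ F (a ∷ l) r deg i r≤2i = trans (coeff-+ₚ (F a) (Σ F l) i)
    (cong₂ ℤ._+_ (deg (here refl) i r≤2i) (DegLtHalf-Σ F l r (deg ∘ there) i r≤2i))

  Σ-++ : ∀ (F : A → Poly) l₁ l₂ → Σ F (l₁ ++ l₂) ≋ Σ F l₁ +ₚ Σ F l₂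
  Σ-++ F []       l₂ = ≋-refl
  Σ-++ F (a ∷ l₁) l₂ = ≋-trans (+ₚ-congˡ (F a) (Σ-++ F l₁ l₂)) (≋-sym (+ₚ-assoc (F a) (Σ F l₁) (Σ F l₂)))

  Σ-extract : ∀ (_≟_ : DecidableEquality A) (F : A → Poly) {l c} → Unique l → c ∈ l →
              Σ F l ≋ F c +ₚ Σ F (filter (λ a → ¬? (a ≟ c)) l)
  Σ-extract _≟_ F {a ∷ l} {c} (a∉l ∷ l!) c∈a∷l with a ≟ c
  ... | yes refl = +ₚ-congˡ (F a) (≡⇒≋ (cong (Σ F) (sym (filter-all (λ a → ¬? (a ≟ c)) (All.map (_∘ sym) a∉l)))))
  ... | no  a≢c with c∈a∷l
  ...   | here c≡a  = ⊥-elim (a≢c (sym c≡a))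
  ...   | there c∈l = ≋-trans (+ₚ-congˡ (F a) (Σ-extract _≟_ F l! c∈l))
                             (x∙yz≈y∙xz (F a) (F c) (Σ F (filter (λ a → ¬? (a ≟ c)) l)))

module _ {A B : Set} where

  Σ-map : ∀ (F : B → Poly) (f : A → B) l → Σ F (map f l) ≡ Σ (F ∘ f) l
  Σ-map F f []      = refl
  Σ-map F f (a ∷ l) = cong (F (f a) +ₚ_) (Σ-map F f l)

  Σ-swap : ∀ (F : A → B → Poly) l₁ l₂ → Σ (λ a → Σ (F a) l₂) l₁ ≋ Σ (λ b → Σ (λ a → F a b) l₁) l₂
  Σ-swap F []       l₂ = ≋-sym (Σ-zero l₂ λ _ → ≋-refl)
  Σ-swap F (a ∷ l₁) l₂ = ≋-trans (+ₚ-congˡ (Σ (F a) l₂) (Σ-swap F l₁ l₂))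
    (≋-sym (Σ-+ₚ (F a) (λ b → Σ (λ a → F a b) l₁) l₂))

when : ∀ {P : Set} → Dec P → Poly → Poly
when (yes _) p = p
when (no  _) _ = []

module _ {P : Set} where

  when-cong : ∀ (d : Dec P) {p q} → (P → p ≋ q) → when d p ≋ when d q
  when-cong (yes x) p≋q = p≋q x
  when-cong (no  _) _   = ≋-refl

  Σ-when : ∀ {A : Set} (d : Dec P) (F : A → Poly) l → when d (Σ F l) ≋ Σ (λ a → when d (F a)) l
  Σ-when (yes _) F l = ≋-refl
  Σ-when (no  _) F l = ≋-sym (Σ-zero l λ _ → ≋-refl)

module _ {P Q : Set} where

  when-× : ∀ (d : Dec P) (e : Dec Q) p → when d (when e p) ≋ when (d ×-dec e) p
  when-× (yes _) (yes _) p = ≋-refl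
  when-× (yes _) (no  _) p = ≋-refl
  when-× (no  _) _       p = ≋-refl

  when-⇔ : ∀ (d : Dec P) (e : Dec Q) p → (P → Q) → (Q → P) → when d p ≋ when e p
  when-⇔ (yes _) (yes _) p P⇒Q Q⇒P = ≋-refl
  when-⇔ (yes x) (no ¬y) p P⇒Q Q⇒P = ⊥-elim (¬y (P⇒Q x))
  when-⇔ (no ¬x) (yes y) p P⇒Q Q⇒P = ⊥-elim (¬x (Q⇒P y))
  when-⇔ (no  _) (no  _) p P⇒Q Q⇒P = ≋-refl

Σ-filter : ∀ {A : Set} {P : A → Set} (P? : ∀ a → Dec (P a)) (F : A → Poly) l →
           Σ F (filter P? l) ≋ Σ (λ a → when (P? a) (F a)) l
Σ-filter P? F []      = ≋-refl
Σ-filter P? F (a ∷ l) with P? a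
... | yes _ = +ₚ-congˡ (F a) (Σ-filter P? F l)
... | no  _ = Σ-filter P? F l

filter-map : ∀ {A B : Set} {P : B → Set} (P? : ∀ b → Dec (P b)) (f : A → B) xs →
             filter P? (map f xs) ≡ map f (filter (P? ∘ f) xs)
filter-map P? f []       = refl
filter-map P? f (x ∷ xs) with P? (f x)
... | yes _ = cong (f x ∷_) (filter-map P? f xs)
... | no  _ = filter-map P? f xs

-- Incidence algebras of finite orders

InU⇒≋1ₚ : ∀ B (p : Inc B) → InU B p → ∀ z → p z z ≋ 1ₚ
InU⇒≋1ₚ B p p-unit z = coeffwise (p-unit z)

module _ (B : FinOrd) where
  open FinOrd B

  ∈-interval : ∀ {z z' w} → w ∈ interval z z' → z ≤ w × w ≤ z'
  ∈-interval {z} {z'} w∈ = proj₂ (∈-filter⁻ (λ w → (z ≤? w) ×-dec (w ≤? z')) {xs = elems} w∈)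

  ⊛-≋0ˡ : ∀ p q z z' → (∀ {w} → z ≤ w → w ≤ z' → p z w ≋ []) → _⊛_ B p q z z' ≋ []
  ⊛-≋0ˡ p q z z' p≋0 = Σ-zero (interval z z') λ {w} w∈ → *ₚ-congʳ (q w z') (uncurry p≋0 (∈-interval w∈))

  ⊛-cong-interval : ∀ p p' q q' z z' → (∀ {w} → z ≤ w → w ≤ z' → p z w *ₚ q w z' ≋ p' z w *ₚ q' w z') →
                    _⊛_ B p q z z' ≋ _⊛_ B p' q' z z'
  ⊛-cong-interval p p' q q' z z' terms≋ = Σ-cong (interval z z') λ w∈ → uncurry terms≋ (∈-interval w∈)

  module _ (≤-trans : Transitive _≤_) where

    private
      ∈[_,_]? : ∀ z z' w → Dec (z ≤ w × w ≤ z')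
      ∈[ z , z' ]? w = (z ≤? w) ×-dec (w ≤? z')

      Σ-nested : ∀ (lo hi : Carrier → Carrier) (G : Carrier → Carrier → Poly) z z' →
        Σ (λ w → Σ (G w) (interval (lo w) (hi w))) (interval z z') ≋
        Σ (λ w → Σ (λ u → when (∈[ z , z' ]? w ×-dec ∈[ lo w , hi w ]? u) (G w u)) elems) elems
      Σ-nested lo hi G z z' = ≋-trans (Σ-filter ∈[ z , z' ]? _ elems) (Σ-cong elems λ {w} _ →
        ≋-trans (when-cong (∈[ z , z' ]? w) (λ _ → Σ-filter ∈[ lo w , hi w ]? (G w) elems))
        (≋-trans (Σ-when (∈[ z , z' ]? w) _ elems) (Σ-cong elems λ {u} _ →
          when-× (∈[ z , z' ]? w) (∈[ lo w , hi w ]? u) (G w u))))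

    Σ-interval-swap : ∀ (F : Carrier → Carrier → Poly) z z' →
      Σ (λ w → Σ (λ u → F u w) (interval z w)) (interval z z') ≋
      Σ (λ u → Σ (F u) (interval u z')) (interval z z')
    Σ-interval-swap F z z' = begin
      Σ (λ w → Σ (λ u → F u w) (interval z w)) (interval z z')
        ≈⟨ Σ-nested (λ _ → z) (λ w → w) (λ w u → F u w) z z' ⟩
      Σ (λ w → Σ (λ u → when (∈[ z , z' ]? w ×-dec ∈[ z , w ]? u) (F u w)) elems) elems
        ≈⟨ Σ-swap _ elems elems ⟩
      Σ (λ u → Σ (λ w → when (∈[ z , z' ]? w ×-dec ∈[ z , w ]? u) (F u w)) elems) elems
        ≈⟨ Σ-cong elems (λ {u} _ → Σ-cong elems λ {w} _ →
             when-⇔ (∈[ z , z' ]? w ×-dec ∈[ z , w ]? u) (∈[ z , z' ]? u ×-dec ∈[ u , z' ]? w) (F u w)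
               (λ ((z≤w , w≤z') , (z≤u , u≤w)) → (z≤u , ≤-trans u≤w w≤z') , (u≤w , w≤z'))
               (λ ((z≤u , u≤z') , (u≤w , w≤z')) → (≤-trans z≤u u≤w , w≤z') , (z≤u , u≤w))) ⟩
      Σ (λ u → Σ (λ w → when (∈[ z , z' ]? u ×-dec ∈[ u , z' ]? w) (F u w)) elems) elems
        ≈⟨ Σ-nested (λ u → u) (λ _ → z') F z z' ⟨
      Σ (λ u → Σ (F u) (interval u z')) (interval z z')
        ∎
      where open ≋-Reasoning

    ⊛-assoc : ∀ p q s z z' → _⊛_ B (_⊛_ B p q) s z z' ≋ _⊛_ B p (_⊛_ B q s) z z'
    ⊛-assoc p q s z z' = begin
      Σ (λ w → Σ (λ u → p z u *ₚ q u w) (interval z w) *ₚ s w z') (interval z z')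
        ≈⟨ Σ-cong (interval z z') (λ {w} _ → ≋-trans (*ₚ-distribʳ-Σ (s w z') _ (interval z w))
                                                (Σ-cong (interval z w) λ {u} _ → *ₚ-assoc (p z u) (q u w) (s w z'))) ⟩
      Σ (λ w → Σ (λ u → p z u *ₚ (q u w *ₚ s w z')) (interval z w)) (interval z z')
        ≈⟨ Σ-interval-swap (λ u w → p z u *ₚ (q u w *ₚ s w z')) z z' ⟩
      Σ (λ u → Σ (λ w → p z u *ₚ (q u w *ₚ s w z')) (interval u z')) (interval z z')
        ≈⟨ Σ-cong (interval z z') (λ {u} _ → *ₚ-distribˡ-Σ (p z u) (λ w → q u w *ₚ s w z') (interval u z')) ⟨
      Σ (λ u → p z u *ₚ Σ (λ w → q u w *ₚ s w z') (interval u z')) (interval z z')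
        ∎
      where open ≋-Reasoning

module _ (B : FinPoset) where
  open FinPoset B
  open IsPartialOrder isPartialOrder using () renaming (refl to ≤-refl)

  interval⁻ : Carrier → Carrier → List Carrier
  interval⁻ z z' = filter (λ w → ¬? (w ≟ z')) (interval z z')

  ∈-interval⁻ : ∀ {z z' w} → w ∈ interval⁻ z z' → (z ≤ w × w ≤ z') × w ≢ z'
  ∈-interval⁻ {z} {z'} w∈ =
    let w∈[z,z'] , w≢z' = ∈-filter⁻ (λ w → ¬? (w ≟ z')) {xs = interval z z'} w∈
    in ∈-interval ord w∈[z,z'] , w≢z'

  Σ-interval-extract : ∀ (F : Carrier → Poly) {z z' w} → z ≤ w → w ≤ z' →
    Σ F (interval z z') ≋ F w +ₚ Σ F (filter (λ u → ¬? (u ≟ w)) (interval z z'))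
  Σ-interval-extract F {z} {z'} {w} z≤w w≤z' = Σ-extract _≟_ F
    (Unique.filter⁺ (λ w → (z ≤? w) ×-dec (w ≤? z')) elems-unique)
    (∈-filter⁺ (λ w → (z ≤? w) ×-dec (w ≤? z')) (elems-complete w) (z≤w , w≤z'))

  Σ-interval : ∀ (F : Carrier → Poly) {z z'} → z ≤ z' → Σ F (interval z z') ≋ F z' +ₚ Σ F (interval⁻ z z')
  Σ-interval F z≤z' = Σ-interval-extract F z≤z' ≤-refl

  ⊛≋0⇒≋0 : ∀ r → IsWeakRankFunction ord r → ∀ p q → InU ord q →
           (∀ z z' → z ≤ z' → _⊛_ ord p q z z' ≋ []) → ∀ z z' → z ≤ z' → p z z' ≋ []
  ⊛≋0⇒≋0 r (r-pos , r-add) p q q-unit pq≋0 z z' = go z z' (<-wellFounded (r z z'))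
    where
    go : ∀ z z' → Acc ℕ._<_ (r z z') → z ≤ z' → p z z' ≋ []
    go z z' (acc smaller) z≤z' = begin
      p z z'                                              ≈⟨ *ₚ-identityʳ (p z z') ⟨
      p z z' *ₚ 1ₚ                                        ≈⟨ *ₚ-congˡ (p z z') (coeffwise (q-unit z')) ⟨
      p z z' *ₚ q z' z'                                   ≈⟨ +ₚ-identityʳ _ ⟨
      p z z' *ₚ q z' z' +ₚ []                             ≈⟨ +ₚ-congˡ (p z z' *ₚ q z' z') (Σ-zero (interval⁻ z z') lower) ⟨
      p z z' *ₚ q z' z' +ₚ Σ (λ w → p z w *ₚ q w z') (interval⁻ z z')
                                                          ≈⟨ Σ-interval (λ w → p z w *ₚ q w z') z≤z' ⟨
      _⊛_ ord p q z z'                                    ≈⟨ pq≋0 z z' z≤z' ⟩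
      []                                                  ∎
      where
      open ≋-Reasoning
      lower : ∀ {w} → w ∈ interval⁻ z z' → p z w *ₚ q w z' ≋ []
      lower {w} w∈ with ∈-interval⁻ w∈
      ... | (z≤w , w≤z') , w≢z' = *ₚ-congʳ (q w z') (go z w (smaller r[z,w]<r[z,z']) z≤w)
        where
        r[z,w]<r[z,z'] : r z w ℕ.< r z z'
        r[z,w]<r[z,z'] = subst (r z w ℕ.<_) (sym (r-add z w z' z≤w w≤z'))
          (ℕP.m<m+n (r z w) (r-pos w z' (w≤z' , w≢z')))

Δ-≋0 : ∀ B r (p : Inc B) z z' → p z z' ≋ [] → Δ B r p z z' ≋ []
Δ-≋0 B r p z z' p≋0 with FinOrd._≟_ B z z'
... | yes _ = ≋-refl
... | no  _ = Δₚ-zero (r z z') p≋0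

-- Rows over an up-set

-- For x ∈ X the hypotheses below hold with b = σ(x), R = r(x, ·), U = g(x, ·),
-- H = h_σ(x, ·), L = ℓ_σ(x, ·) and G, K the restrictions of g_Γ, κ_Γ to Y.
module RelativeKLS (Y : FinPoset) where
  open FinPoset Y
  open IsPartialOrder isPartialOrder using () renaming (refl to ≤-refl; trans to ≤-trans)

  module _
    (r : WeakRank ord) (r-weak : IsWeakRankFunction ord r)
    (G K : Inc ord) (G-half : InIHalf ord r G) (G-unit : InU ord G) (K-unit : InU ord K)
    (G-rev : ∀ {y y'} → y ≤ y' → revₚ (r y y') (G y y') ≋ _⊛_ ord G K y y')
    (b : Carrier) (R : Carrier → ℕ)
    (R-pos : ∀ {y} → b ≤ y → 1 ℕ.≤ R y)
    (R-add : ∀ {y' y} → b ≤ y' → y' ≤ y → R y ≡ R y' ℕ.+ r y' y)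
    (U H L : Carrier → Poly)
    (U-half : ∀ {y} → b ≤ y → DegLtHalf (U y) (R y))
    (U-rev : ∀ {y} → b ≤ y →
             revₚ (R y) (U y) ≋ Σ (λ y' → (t-1 *ₚ H y' +ₚ U y') *ₚ K y' y) (interval b y))
    (H-def : ∀ {y} → b ≤ y → H y ≋ Σ (λ y' → L y' *ₚ G y' y) (interval b y))
    where

    infixl 7 _◃_ _◃⁻_
    _◃_ _◃⁻_ : (Carrier → Poly) → Inc ord → Carrier → Poly
    (u ◃ p)  y = Σ (λ y' → u y' *ₚ p y' y) (interval b y)
    (u ◃⁻ p) y = Σ (λ y' → u y' *ₚ p y' y) (interval⁻ Y b y)

    ◃-unit : ∀ u p {y} → p y y ≋ 1ₚ → b ≤ y → (u ◃ p) y ≋ u y +ₚ (u ◃⁻ p) y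
    ◃-unit u p {y} p≋1 b≤y = ≋-trans (Σ-interval Y (λ y' → u y' *ₚ p y' y) b≤y)
      (+ₚ-congʳ ((u ◃⁻ p) y) (≋-trans (*ₚ-congˡ (u y) p≋1) (*ₚ-identityʳ (u y))))

    ◃-assoc : ∀ u p q y → ((u ◃ p) ◃ q) y ≋ (u ◃ _⊛_ ord p q) y
    ◃-assoc u p q = ⊛-assoc ord ≤-trans (λ _ → u) p q b

    ◃-distribʳ : ∀ u v p y → ((λ y' → u y' +ₚ v y') ◃ p) y ≋ (u ◃ p) y +ₚ (v ◃ p) y
    ◃-distribʳ u v p y = ≋-trans (Σ-cong (interval b y) λ {y'} _ → *ₚ-distribʳ-+ₚ (u y') (v y') (p y' y))
      (Σ-+ₚ (λ y' → u y' *ₚ p y' y) (λ y' → v y' *ₚ p y' y) (interval b y))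

    *ₚ-◃ : ∀ s u p y → s *ₚ (u ◃ p) y ≋ ((λ y' → s *ₚ u y') ◃ p) y
    *ₚ-◃ s u p y = ≋-trans (*ₚ-distribˡ-Σ s (λ y' → u y' *ₚ p y' y) (interval b y))
      (Σ-cong (interval b y) λ {y'} _ → ≋-sym (*ₚ-assoc s (u y') (p y' y)))

    D A E : Carrier → Poly
    D y = Δₚ (R y) (L y)
    A y = t-1 *ₚ L y +ₚ D y
    E y = U y -ₚ (D ◃ G) y

    revG : Inc ord
    revG = rev ord r G

    revG-unit : ∀ y → revG y y ≋ 1ₚ
    revG-unit y = subst (λ n → revₚ n (G y y) ≋ 1ₚ) r[y,y]≡0 (revₚ-cong 0 (InU⇒≋1ₚ ord G G-unit y))
      where
      r[y,y]≡0 : 0 ≡ r y y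
      r[y,y]≡0 = ℕP.+-cancelˡ-≡ (r y y) 0 (r y y)
        (trans (ℕP.+-identityʳ (r y y)) (proj₂ r-weak y y y ≤-refl ≤-refl))

    Below : (Carrier → Set) → Carrier → Set
    Below P y = ∀ {y'} → y' ∈ interval⁻ Y b y → P y'

    t-1*H+U≋A◃G+E : ∀ {y} → b ≤ y → t-1 *ₚ H y +ₚ U y ≋ (A ◃ G) y +ₚ E y
    t-1*H+U≋A◃G+E {y} b≤y = begin
      t-1 *ₚ H y +ₚ U y
        ≈⟨ +ₚ-congʳ (U y) (≋-trans (*ₚ-congˡ t-1 (H-def b≤y)) (*ₚ-◃ t-1 L G y)) ⟩
      X +ₚ U y
        ≈⟨ +ₚ-congˡ X (//-rightDividesˡ ((D ◃ G) y) (U y)) ⟨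
      X +ₚ (E y +ₚ (D ◃ G) y)
        ≈⟨ x∙yz≈y∙xz X (E y) ((D ◃ G) y) ⟩
      E y +ₚ (X +ₚ (D ◃ G) y)
        ≈⟨ +ₚ-comm (E y) (X +ₚ (D ◃ G) y) ⟩
      (X +ₚ (D ◃ G) y) +ₚ E y
        ≈⟨ +ₚ-congʳ (E y) (◃-distribʳ (λ y' → t-1 *ₚ L y') D G y) ⟨
      (A ◃ G) y +ₚ E y
        ∎
      where
      open ≋-Reasoning
      X : Poly
      X = ((λ y' → t-1 *ₚ L y') ◃ G) y

    E◃K : ∀ {y} → b ≤ y → Below (λ y' → E y' ≋ []) y → (E ◃ K) y ≋ E y
    E◃K {y} b≤y E≋0 = ≋-trans (◃-unit E K (InU⇒≋1ₚ ord K K-unit y) b≤y)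
      (≋-trans (+ₚ-congˡ (E y) (Σ-zero (interval⁻ Y b y) λ {y'} y'∈ → *ₚ-congʳ (K y' y) (E≋0 y'∈)))
               (+ₚ-identityʳ (E y)))

    DegLtHalf-U-D◃⁻G : ∀ {y} → b ≤ y → DegLtHalf (U y -ₚ (D ◃⁻ G) y) (R y)
    DegLtHalf-U-D◃⁻G {y} b≤y = DegLtHalf-minusₚ (U y) ((D ◃⁻ G) y) (R y) (U-half b≤y)
      (DegLtHalf-Σ (λ y' → D y' *ₚ G y' y) (interval⁻ Y b y) (R y) term-half)
      where
      term-half : ∀ {y'} → y' ∈ interval⁻ Y b y → DegLtHalf (D y' *ₚ G y' y) (R y)
      term-half {y'} y'∈ with ∈-interval⁻ Y y'∈
      ... | (b≤y' , y'≤y) , y'≢y = subst (DegLtHalf (D y' *ₚ G y' y)) (sym (R-add b≤y' y'≤y))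
        (DegLtHalf-*ₚ (D y') (G y' y) (R y') (r y' y)
          (DegLtHalf-Δₚ (R y') (L y') (R-pos b≤y')) (proj₂ G-half y' y (y'≤y , y'≢y)))

    revₚ-D◃⁻G : ∀ {y} → b ≤ y → Below (λ y' → revₚ (R y') (D y') ≋ A y') y →
                revₚ (R y) ((D ◃⁻ G) y) ≋ (A ◃⁻ revG) y
    revₚ-D◃⁻G {y} b≤y revD≋A = ≋-trans (revₚ-Σ (R y) (λ y' → D y' *ₚ G y' y) (interval⁻ Y b y))
      (Σ-cong (interval⁻ Y b y) rev-term)
      where
      rev-term : ∀ {y'} → y' ∈ interval⁻ Y b y → revₚ (R y) (D y' *ₚ G y' y) ≋ A y' *ₚ revG y' y
      rev-term {y'} y'∈ with ∈-interval⁻ Y y'∈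
      ... | (b≤y' , y'≤y) , _ = ≋-trans
        (subst (λ n → revₚ n (D y' *ₚ G y' y) ≋ revₚ (R y') (D y') *ₚ revG y' y) (sym (R-add b≤y' y'≤y))
          (revₚ-*ₚ (R y') (r y' y) (D y') (G y' y)
            (DegLtHalf⇒DegLe (D y') (R y') (DegLtHalf-Δₚ (R y') (L y') (R-pos b≤y')))
            (proj₁ G-half y' y y'≤y)))
        (*ₚ-congʳ (revG y' y) (revD≋A y'∈))

    revₚ-U : ∀ {y} → b ≤ y → Below (λ y' → E y' ≋ []) y →
             revₚ (R y) (U y) ≋ (A y +ₚ (A ◃⁻ revG) y) +ₚ E y
    revₚ-U {y} b≤y E≋0 = begin
      revₚ (R y) (U y)
        ≈⟨ U-rev b≤y ⟩
      Σ (λ y'' → (t-1 *ₚ H y'' +ₚ U y'') *ₚ K y'' y) (interval b y)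
        ≈⟨ Σ-cong (interval b y) (λ {y''} y''∈ → *ₚ-congʳ (K y'' y) (t-1*H+U≋A◃G+E (proj₁ (∈-interval ord y''∈)))) ⟩
      ((λ y'' → (A ◃ G) y'' +ₚ E y'') ◃ K) y
        ≈⟨ ◃-distribʳ (A ◃ G) E K y ⟩
      ((A ◃ G) ◃ K) y +ₚ (E ◃ K) y
        ≈⟨ +ₚ-cong (◃-assoc A G K y) (E◃K b≤y E≋0) ⟩
      (A ◃ _⊛_ ord G K) y +ₚ E y
        ≈⟨ +ₚ-congʳ (E y) (Σ-cong (interval b y) λ {y'} y'∈ → *ₚ-congˡ (A y') (G-rev (proj₂ (∈-interval ord y'∈)))) ⟨
      (A ◃ revG) y +ₚ E y
        ≈⟨ +ₚ-congʳ (E y) (◃-unit A revG (revG-unit y) b≤y) ⟩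
      (A y +ₚ (A ◃⁻ revG) y) +ₚ E y
        ∎
      where open ≋-Reasoning

    U-D◃⁻G≋D+E : ∀ {y} → b ≤ y → U y -ₚ (D ◃⁻ G) y ≋ D y +ₚ E y
    U-D◃⁻G≋D+E {y} b≤y = ∙-cancelʳ P (U y -ₚ P) (D y +ₚ E y) (begin
      (U y -ₚ P) +ₚ P       ≈⟨ //-rightDividesˡ P (U y) ⟩
      U y                   ≈⟨ //-rightDividesˡ ((D ◃ G) y) (U y) ⟨
      E y +ₚ (D ◃ G) y      ≈⟨ +ₚ-comm (E y) ((D ◃ G) y) ⟩
      (D ◃ G) y +ₚ E y      ≈⟨ +ₚ-congʳ (E y) (◃-unit D G (InU⇒≋1ₚ ord G G-unit y) b≤y) ⟩
      (D y +ₚ P) +ₚ E y     ≈⟨ xy∙z≈xz∙y (D y) P (E y) ⟩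
      (D y +ₚ E y) +ₚ P     ∎)
      where
      open ≋-Reasoning
      P : Poly
      P = (D ◃⁻ G) y

    Invariant : Carrier → Set
    Invariant y = E y ≋ [] × revₚ (R y) (D y) ≋ A y

    -- v is the part of U y not yet accounted for by the D y' with y' < y; the two
    -- expansions of its reversal force v ≋ D y by the uniqueness of Δₚ.
    invariant-step : ∀ {y} → b ≤ y → Below Invariant y → Invariant y
    invariant-step {y} b≤y ih = E≋0 , revD≋A
      where
      open ≋-Reasoning
      P v S : Poly
      P = (D ◃⁻ G) y
      v = U y -ₚ P
      S = (A ◃⁻ revG) y

      revv≋A+E : revₚ (R y) v ≋ A y +ₚ E y
      revv≋A+E = ∙-cancelʳ S (revₚ (R y) v) (A y +ₚ E y) (begin
        revₚ (R y) v +ₚ S              ≈⟨ +ₚ-congˡ (revₚ (R y) v) (revₚ-D◃⁻G b≤y (proj₂ ∘ ih)) ⟨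
        revₚ (R y) v +ₚ revₚ (R y) P   ≈⟨ revₚ-+ₚ (R y) v P ⟨
        revₚ (R y) (v +ₚ P)            ≈⟨ revₚ-cong (R y) (//-rightDividesˡ P (U y)) ⟩
        revₚ (R y) (U y)               ≈⟨ revₚ-U b≤y (proj₁ ∘ ih) ⟩
        (A y +ₚ S) +ₚ E y              ≈⟨ xy∙z≈xz∙y (A y) S (E y) ⟩
        (A y +ₚ E y) +ₚ S              ∎)

      v≋D : v ≋ D y
      v≋D = Δₚ-unique (R y) (L y) v (R-pos b≤y) (DegLtHalf-U-D◃⁻G b≤y) (begin
        revₚ (R y) v                  ≈⟨ revv≋A+E ⟩
        (t-1 *ₚ L y +ₚ D y) +ₚ E y    ≈⟨ xy∙z≈yz∙x (t-1 *ₚ L y) (D y) (E y) ⟩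
        (D y +ₚ E y) +ₚ t-1 *ₚ L y    ≈⟨ +ₚ-congʳ (t-1 *ₚ L y) (U-D◃⁻G≋D+E b≤y) ⟨
        v +ₚ t-1 *ₚ L y               ∎)

      E≋0 : E y ≋ []
      E≋0 = identityʳ-unique (D y) (E y) (≋-trans (≋-sym (U-D◃⁻G≋D+E b≤y)) v≋D)

      revD≋A : revₚ (R y) (D y) ≋ A y
      revD≋A = begin
        revₚ (R y) (D y)   ≈⟨ revₚ-cong (R y) v≋D ⟨
        revₚ (R y) v       ≈⟨ revv≋A+E ⟩
        A y +ₚ E y         ≈⟨ +ₚ-congˡ (A y) E≋0 ⟩
        A y +ₚ []          ≈⟨ +ₚ-identityʳ (A y) ⟩
        A y                ∎

    invariant : ∀ {y} → b ≤ y → Invariant y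
    invariant {y} = go y (<-wellFounded (R y))
      where
      go : ∀ y → Acc ℕ._<_ (R y) → b ≤ y → Invariant y
      go y (acc smaller) b≤y = invariant-step b≤y below
        where
        below : Below Invariant y
        below {y'} y'∈ with ∈-interval⁻ Y y'∈
        ... | (b≤y' , y'≤y) , y'≢y = go y' (smaller R[y']<R[y]) b≤y'
          where
          R[y']<R[y] : R y' ℕ.< R y
          R[y']<R[y] = subst (R y' ℕ.<_) (sym (R-add b≤y' y'≤y))
            (ℕP.m<m+n (R y') (proj₁ r-weak y' y (y'≤y , y'≢y)))

    U≋Δₚ[L]◃G : ∀ {y} → b ≤ y → U y ≋ (D ◃ G) y
    U≋Δₚ[L]◃G b≤y = x∙y⁻¹≈ε⇒x≈y _ _ (proj₁ (invariant b≤y))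

-- The mapping cylinder Γ

module Cylinder (X Y : FinPoset) (ρX : FinPoset.Carrier X → ℤ) (ρY : FinPoset.Carrier Y → ℤ)
                (σ : FinPoset.Carrier X → FinPoset.Carrier Y) where
  private
    module X = FinPoset X
    module Y = FinPoset Y

  Γ : FinOrd
  Γ = Cyl X Y ρX ρY σ

  open FinOrd Γ using () renaming (Carrier to Γ-Carrier; _≤_ to _≤Γ_; _≤?_ to _≤Γ?_)

  _∣X : ∀ {A : Set} → (Γ-Carrier → Γ-Carrier → A) → X.Carrier → X.Carrier → A
  (f ∣X) a a' = f (inj₁ a) (inj₁ a')

  _∣Y : ∀ {A : Set} → (Γ-Carrier → Γ-Carrier → A) → Y.Carrier → Y.Carrier → A
  (f ∣Y) y y' = f (inj₂ y) (inj₂ y')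

  X-part : X.Carrier → Y.Carrier → List X.Carrier
  X-part x y = filter (λ a → (x X.≤? a) ×-dec (σ a Y.≤? y)) X.elems

  interval-Γ : ∀ z z' → FinOrd.interval Γ z z' ≡
    map inj₁ (filter (λ a → (z ≤Γ? inj₁ a) ×-dec (inj₁ a ≤Γ? z')) X.elems) ++
    map inj₂ (filter (λ c → (z ≤Γ? inj₂ c) ×-dec (inj₂ c ≤Γ? z')) Y.elems)
  interval-Γ z z' = trans (filter-++ ∈[z,z']? (map inj₁ X.elems) (map inj₂ Y.elems))
    (cong₂ _++_ (filter-map ∈[z,z']? inj₁ X.elems) (filter-map ∈[z,z']? inj₂ Y.elems))
    where
    ∈[z,z']? : ∀ w → Dec (z ≤Γ w × w ≤Γ z')
    ∈[z,z']? w = (z ≤Γ? w) ×-dec (w ≤Γ? z')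

  interval-inj₁ : ∀ a a' → FinOrd.interval Γ (inj₁ a) (inj₁ a') ≡ map inj₁ (X.interval a a')
  interval-inj₁ a a' = trans (interval-Γ (inj₁ a) (inj₁ a'))
    (trans (cong (λ ys → map inj₁ (X.interval a a') ++ map inj₂ ys)
                 (filter-none _ (All.universal (λ _ ()) Y.elems)))
           (++-identityʳ _))

  interval-inj₂ : ∀ y y' → FinOrd.interval Γ (inj₂ y) (inj₂ y') ≡ map inj₂ (Y.interval y y')
  interval-inj₂ y y' = trans (interval-Γ (inj₂ y) (inj₂ y'))
    (cong (λ xs → map inj₁ xs ++ map inj₂ (Y.interval y y'))
          (filter-none _ (All.universal (λ _ ()) X.elems)))

  ∈-X-part : ∀ {x y a} → a ∈ X-part x y → x X.≤ a × σ a Y.≤ y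
  ∈-X-part {x} {y} a∈ = proj₂ (∈-filter⁻ (λ a → (x X.≤? a) ×-dec (σ a Y.≤? y)) {xs = X.elems} a∈)

  ⊛-∣X : ∀ p q a a' → _⊛_ Γ p q (inj₁ a) (inj₁ a') ≡ _⊛_ X.ord (p ∣X) (q ∣X) a a'
  ⊛-∣X p q a a' = trans (cong (Σ (λ w → p (inj₁ a) w *ₚ q w (inj₁ a'))) (interval-inj₁ a a'))
    (Σ-map (λ w → p (inj₁ a) w *ₚ q w (inj₁ a')) inj₁ (X.interval a a'))

  ⊛-∣Y : ∀ p q y y' → _⊛_ Γ p q (inj₂ y) (inj₂ y') ≡ _⊛_ Y.ord (p ∣Y) (q ∣Y) y y'
  ⊛-∣Y p q y y' = trans (cong (Σ (λ w → p (inj₂ y) w *ₚ q w (inj₂ y'))) (interval-inj₂ y y'))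
    (Σ-map (λ w → p (inj₂ y) w *ₚ q w (inj₂ y')) inj₂ (Y.interval y y'))

  ⊛-inj₁-inj₂ : ∀ p q x y → _⊛_ Γ p q (inj₁ x) (inj₂ y) ≋
    Σ (λ a → p (inj₁ x) (inj₁ a) *ₚ q (inj₁ a) (inj₂ y)) (X-part x y) +ₚ
    Σ (λ c → p (inj₁ x) (inj₂ c) *ₚ q (inj₂ c) (inj₂ y)) (Y.interval (σ x) y)
  ⊛-inj₁-inj₂ p q x y = ≋-trans (≡⇒≋ (cong (Σ F) (interval-Γ (inj₁ x) (inj₂ y))))
    (≋-trans (Σ-++ F (map inj₁ (X-part x y)) (map inj₂ (Y.interval (σ x) y)))
             (≡⇒≋ (cong₂ _+ₚ_ (Σ-map F inj₁ (X-part x y)) (Σ-map F inj₂ (Y.interval (σ x) y)))))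
    where
    F : Γ-Carrier → Poly
    F w = p (inj₁ x) w *ₚ q w (inj₂ y)

  CylLe-trans : (∀ x x' → x X.≤ x' → σ x Y.≤ σ x') → Transitive _≤Γ_
  CylLe-trans σ-mono {inj₁ _} {inj₁ _} {inj₁ _} = IsPartialOrder.trans X.isPartialOrder
  CylLe-trans σ-mono {inj₁ _} {inj₁ _} {inj₂ _} = IsPartialOrder.trans Y.isPartialOrder ∘ σ-mono _ _
  CylLe-trans σ-mono {inj₁ _} {inj₂ _} {inj₂ _} = IsPartialOrder.trans Y.isPartialOrder
  CylLe-trans σ-mono {inj₂ _} {inj₂ _} {inj₂ _} = IsPartialOrder.trans Y.isPartialOrder
  CylLe-trans σ-mono {inj₁ _} {inj₂ _} {inj₁ _} _ ()
  CylLe-trans σ-mono {inj₂ _} {inj₂ _} {inj₁ _} _ ()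
  CylLe-trans σ-mono {inj₂ _} {inj₁ _} ()

  restrXY°-σ : ∀ p a → restrXY° X Y ρX ρY σ p (inj₁ a) (inj₂ (σ a)) ≡ p (inj₁ a) (inj₂ (σ a))
  restrXY°-σ p a with σ a Y.≟ σ a
  ... | yes _     = refl
  ... | no  σa≢σa = ⊥-elim (σa≢σa refl)

  restrXY°-≢ : ∀ p a c → σ a ≢ c → restrXY° X Y ρX ρY σ p (inj₁ a) (inj₂ c) ≡ []
  restrXY°-≢ p a c σa≢c with σ a Y.≟ c
  ... | yes σa≡c = ⊥-elim (σa≢c σa≡c)
  ... | no  _    = refl

  IsWeakRankFunction-∣X : ∀ {r} → IsWeakRankFunction Γ r → IsWeakRankFunction X.ord (r ∣X)
  IsWeakRankFunction-∣X (r-pos , r-add) =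
    (λ a a' (a≤a' , a≢a') → r-pos (inj₁ a) (inj₁ a') (a≤a' , a≢a' ∘ inj₁-injective)) ,
    (λ a a'' a' → r-add (inj₁ a) (inj₁ a'') (inj₁ a'))

  IsWeakRankFunction-∣Y : ∀ {r} → IsWeakRankFunction Γ r → IsWeakRankFunction Y.ord (r ∣Y)
  IsWeakRankFunction-∣Y (r-pos , r-add) =
    (λ y y' (y≤y' , y≢y') → r-pos (inj₂ y) (inj₂ y') (y≤y' , y≢y' ∘ inj₂-injective)) ,
    (λ y y'' y' → r-add (inj₂ y) (inj₂ y'') (inj₂ y'))

  InIHalf-∣Y : ∀ r p → InIHalf Γ r p → InIHalf Y.ord (r ∣Y) (p ∣Y)
  InIHalf-∣Y r p (p-deg , p-half) =
    (λ y y' → p-deg (inj₂ y) (inj₂ y')) ,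
    (λ y y' (y≤y' , y≢y') → p-half (inj₂ y) (inj₂ y') (y≤y' , y≢y' ∘ inj₂-injective))

  ⊛-inj₁-inj₂-Y-part : ∀ p q x y → (∀ {a} → x X.≤ a → p (inj₁ x) (inj₁ a) ≋ []) →
    _⊛_ Γ p q (inj₁ x) (inj₂ y) ≋ Σ (λ c → p (inj₁ x) (inj₂ c) *ₚ q (inj₂ c) (inj₂ y)) (Y.interval (σ x) y)
  ⊛-inj₁-inj₂-Y-part p q x y p≋0 = ≋-trans (⊛-inj₁-inj₂ p q x y)
    (+ₚ-congʳ _ (Σ-zero (X-part x y) λ {a} a∈ →
      *ₚ-congʳ (q (inj₁ a) (inj₂ y)) (p≋0 (proj₁ (∈-X-part a∈)))))

module Subdivision
  (X Y : FinPoset) (ρX : FinPoset.Carrier X → ℤ) (ρY : FinPoset.Carrier Y → ℤ)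
  (σ : FinPoset.Carrier X → FinPoset.Carrier Y)
  (σ-mono : ∀ x x' → FinPoset._≤_ X x x' → FinPoset._≤_ Y (σ x) (σ x'))
  (r : WeakRank (Cyl X Y ρX ρY σ)) (r-weak : IsWeakRankFunction (Cyl X Y ρX ρY σ) r)
  (κ : Inc (Cyl X Y ρX ρY σ)) (κ-unit : InU (Cyl X Y ρX ρY σ) κ)
  (κ-mult : IsMultiplicative (Cyl X Y ρX ρY σ) κ)
  (g : Inc (Cyl X Y ρX ρY σ)) (g-KLS : IsLeftKLS (Cyl X Y ρX ρY σ) r κ g)
  (h : Inc (Cyl X Y ρX ρY σ)) (h-def : IsHσ X Y ρX ρY σ κ g h)
  (ℓ : Inc (Cyl X Y ρX ρY σ)) (ℓ-def : IsLσ X Y ρX ρY σ g h ℓ)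
  where

  private
    module X = FinPoset X
    module Y = FinPoset Y
  open Cylinder X Y ρX ρY σ
  open FinOrd Γ using () renaming (_≤_ to _≤Γ_)

  g-half : InIHalf Γ r g
  g-half = proj₁ g-KLS

  g-unit : InU Γ g
  g-unit = proj₁ (proj₂ g-KLS)

  g-rev : ∀ {z z'} → z ≤Γ z' → revₚ (r z z') (g z z') ≋ _⊛_ Γ g κ z z'
  g-rev {z} {z'} z≤z' = coeffwise (proj₂ (proj₂ g-KLS) z z' z≤z')

  κ° : Inc Γ
  κ° = restrXY° X Y ρX ρY σ κ

  Δℓ : Inc Γ
  Δℓ = Δ Γ r ℓ

  t-1*h≋g⊛κ° : ∀ {z z'} → z ≤Γ z' → t-1 *ₚ h z z' ≋ _⊛_ Γ g κ° z z'
  t-1*h≋g⊛κ° {z} {z'} z≤z' = coeffwise (h-def z z' z≤z')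

  ℓ⊛g≋h : ∀ {z z'} → z ≤Γ z' → _⊛_ Γ ℓ g z z' ≋ h z z'
  ℓ⊛g≋h {z} {z'} z≤z' = coeffwise (ℓ-def z z' z≤z')

  g⊛κ°-inj₁≋0 : ∀ z a → _⊛_ Γ g κ° z (inj₁ a) ≋ []
  g⊛κ°-inj₁≋0 z a = Σ-zero (FinOrd.interval Γ z (inj₁ a)) λ {w} _ → term w
    where
    term : ∀ w → g z w *ₚ κ° w (inj₁ a) ≋ []
    term (inj₁ _) = *ₚ-zeroʳ (g z _)
    term (inj₂ _) = *ₚ-zeroʳ (g z _)

  h-∣X≋0 : ∀ a a' → a X.≤ a' → h (inj₁ a) (inj₁ a') ≋ []
  h-∣X≋0 a a' a≤a' = t-1*ₚ≋0⇒≋0 (h (inj₁ a) (inj₁ a'))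
    (≋-trans (t-1*h≋g⊛κ° a≤a') (g⊛κ°-inj₁≋0 (inj₁ a) a'))

  h-∣Y≋0 : ∀ y y' → y Y.≤ y' → h (inj₂ y) (inj₂ y') ≋ []
  h-∣Y≋0 y y' y≤y' = t-1*ₚ≋0⇒≋0 (h (inj₂ y) (inj₂ y'))
    (≋-trans (t-1*h≋g⊛κ° y≤y')
    (≋-trans (≡⇒≋ (⊛-∣Y g κ° y y')) (Σ-zero (Y.interval y y') λ {c} _ → *ₚ-zeroʳ (g (inj₂ y) (inj₂ c)))))

  ℓ-∣X≋0 : ∀ a a' → a X.≤ a' → ℓ (inj₁ a) (inj₁ a') ≋ []
  ℓ-∣X≋0 = ⊛≋0⇒≋0 X (r ∣X) (IsWeakRankFunction-∣X r-weak) (ℓ ∣X) (g ∣X) (λ a → g-unit (inj₁ a))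
    λ a a' a≤a' → ≋-trans (≡⇒≋ (sym (⊛-∣X ℓ g a a')))
                  (≋-trans (ℓ⊛g≋h a≤a') (h-∣X≋0 a a' a≤a'))

  ℓ-∣Y≋0 : ∀ y y' → y Y.≤ y' → ℓ (inj₂ y) (inj₂ y') ≋ []
  ℓ-∣Y≋0 = ⊛≋0⇒≋0 Y (r ∣Y) (IsWeakRankFunction-∣Y r-weak) (ℓ ∣Y) (g ∣Y) (λ y → g-unit (inj₂ y))
    λ y y' y≤y' → ≋-trans (≡⇒≋ (sym (⊛-∣Y ℓ g y y')))
                  (≋-trans (ℓ⊛g≋h y≤y') (h-∣Y≋0 y y' y≤y'))

  Δℓ-∣X≋0 : ∀ {a a'} → a X.≤ a' → Δℓ (inj₁ a) (inj₁ a') ≋ []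
  Δℓ-∣X≋0 {a} {a'} a≤a' = Δ-≋0 Γ r ℓ (inj₁ a) (inj₁ a') (ℓ-∣X≋0 a a' a≤a')

  Δℓ-∣Y≋0 : ∀ {y y'} → y Y.≤ y' → Δℓ (inj₂ y) (inj₂ y') ≋ []
  Δℓ-∣Y≋0 {y} {y'} y≤y' = Δ-≋0 Γ r ℓ (inj₂ y) (inj₂ y') (ℓ-∣Y≋0 y y' y≤y')

  -- Multiplicativity factors κ on [a, y] through σ a, the only point where κ° is nonzero.
  κ°⊛κ : ∀ a y → σ a Y.≤ y → _⊛_ Γ κ° κ (inj₁ a) (inj₂ y) ≋ κ (inj₁ a) (inj₂ y)
  κ°⊛κ a y σa≤y = begin
    _⊛_ Γ κ° κ (inj₁ a) (inj₂ y)
      ≈⟨ ⊛-inj₁-inj₂-Y-part κ° κ a y (λ _ → ≋-refl) ⟩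
    Σ F (Y.interval (σ a) y)
      ≈⟨ Σ-interval-extract Y F (IsPartialOrder.refl Y.isPartialOrder) σa≤y ⟩
    F (σ a) +ₚ Σ F (filter (λ c → ¬? (c Y.≟ σ a)) (Y.interval (σ a) y))
      ≈⟨ +ₚ-congˡ (F (σ a)) (Σ-zero (filter (λ c → ¬? (c Y.≟ σ a)) (Y.interval (σ a) y)) off-fibre) ⟩
    F (σ a) +ₚ []
      ≈⟨ +ₚ-identityʳ (F (σ a)) ⟩
    F (σ a)
      ≈⟨ ≡⇒≋ (cong (_*ₚ κ (inj₂ (σ a)) (inj₂ y)) (restrXY°-σ κ a)) ⟩
    κ (inj₁ a) (inj₂ (σ a)) *ₚ κ (inj₂ (σ a)) (inj₂ y)
      ≈⟨ coeffwise (κ-mult (inj₁ a) (inj₂ (σ a)) (inj₂ y) (IsPartialOrder.refl Y.isPartialOrder) σa≤y) ⟨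
    κ (inj₁ a) (inj₂ y)
      ∎
    where
    open ≋-Reasoning
    F : Y.Carrier → Poly
    F c = κ° (inj₁ a) (inj₂ c) *ₚ κ (inj₂ c) (inj₂ y)
    off-fibre : ∀ {c} → c ∈ filter (λ c → ¬? (c Y.≟ σ a)) (Y.interval (σ a) y) → F c ≋ []
    off-fibre {c} c∈ = ≡⇒≋ (cong (_*ₚ κ (inj₂ c) (inj₂ y))
      (restrXY°-≢ κ a c (≢-sym (proj₂ (∈-filter⁻ (λ c → ¬? (c Y.≟ σ a)) {xs = Y.interval (σ a) y} c∈)))))

  -- (g · κ°) · κ = g · (κ° · κ), and κ° · κ agrees with κ from X to Y and vanishes on Y.
  g⊛κ-X-part : ∀ x y → σ x Y.≤ y →
    Σ (λ a → g (inj₁ x) (inj₁ a) *ₚ κ (inj₁ a) (inj₂ y)) (X-part x y) ≋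
    Σ (λ c → t-1 *ₚ h (inj₁ x) (inj₂ c) *ₚ κ (inj₂ c) (inj₂ y)) (Y.interval (σ x) y)
  g⊛κ-X-part x y σx≤y = begin
    Σ (λ a → g (inj₁ x) (inj₁ a) *ₚ κ (inj₁ a) (inj₂ y)) (X-part x y)
      ≈⟨ Σ-cong (X-part x y) (λ {a} a∈ →
           *ₚ-congˡ (g (inj₁ x) (inj₁ a)) (κ°⊛κ a y (proj₂ (∈-X-part a∈)))) ⟨
    Σ (λ a → g (inj₁ x) (inj₁ a) *ₚ _⊛_ Γ κ° κ (inj₁ a) (inj₂ y)) (X-part x y)
      ≈⟨ +ₚ-identityʳ _ ⟨
    Σ (λ a → g (inj₁ x) (inj₁ a) *ₚ _⊛_ Γ κ° κ (inj₁ a) (inj₂ y)) (X-part x y) +ₚ []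
      ≈⟨ +ₚ-congˡ _ (Σ-zero (Y.interval (σ x) y) λ {c} _ → κ°⊛κ-inj₂≋0 c) ⟨
    _ +ₚ Σ (λ c → g (inj₁ x) (inj₂ c) *ₚ _⊛_ Γ κ° κ (inj₂ c) (inj₂ y)) (Y.interval (σ x) y)
      ≈⟨ ⊛-inj₁-inj₂ g (_⊛_ Γ κ° κ) x y ⟨
    _⊛_ Γ g (_⊛_ Γ κ° κ) (inj₁ x) (inj₂ y)
      ≈⟨ ⊛-assoc Γ (λ {z w z'} → CylLe-trans σ-mono {z} {w} {z'}) g κ° κ (inj₁ x) (inj₂ y) ⟨
    _⊛_ Γ (_⊛_ Γ g κ°) κ (inj₁ x) (inj₂ y)
      ≈⟨ ⊛-inj₁-inj₂-Y-part (_⊛_ Γ g κ°) κ x y (λ {a} _ → g⊛κ°-inj₁≋0 (inj₁ x) a) ⟩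
    Σ (λ c → _⊛_ Γ g κ° (inj₁ x) (inj₂ c) *ₚ κ (inj₂ c) (inj₂ y)) (Y.interval (σ x) y)
      ≈⟨ Σ-cong (Y.interval (σ x) y) (λ {c} c∈ → *ₚ-congʳ (κ (inj₂ c) (inj₂ y))
           (t-1*h≋g⊛κ° (proj₁ (∈-interval Y.ord c∈)))) ⟨
    Σ (λ c → t-1 *ₚ h (inj₁ x) (inj₂ c) *ₚ κ (inj₂ c) (inj₂ y)) (Y.interval (σ x) y)
      ∎
    where
    open ≋-Reasoning
    κ°⊛κ-inj₂≋0 : ∀ c → g (inj₁ x) (inj₂ c) *ₚ _⊛_ Γ κ° κ (inj₂ c) (inj₂ y) ≋ []
    κ°⊛κ-inj₂≋0 c = ≋-trans (*ₚ-congˡ (g (inj₁ x) (inj₂ c)) (Σ-zero (FinOrd.interval Γ (inj₂ c) (inj₂ y)) λ _ → ≋-refl))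
                            (*ₚ-zeroʳ (g (inj₁ x) (inj₂ c)))

  revₚ-g-inj₁-inj₂ : ∀ x {y} → σ x Y.≤ y → revₚ (r (inj₁ x) (inj₂ y)) (g (inj₁ x) (inj₂ y)) ≋
    Σ (λ c → (t-1 *ₚ h (inj₁ x) (inj₂ c) +ₚ g (inj₁ x) (inj₂ c)) *ₚ κ (inj₂ c) (inj₂ y)) (Y.interval (σ x) y)
  revₚ-g-inj₁-inj₂ x {y} σx≤y = begin
    revₚ (r (inj₁ x) (inj₂ y)) (g (inj₁ x) (inj₂ y))
      ≈⟨ g-rev σx≤y ⟩
    _⊛_ Γ g κ (inj₁ x) (inj₂ y)
      ≈⟨ ⊛-inj₁-inj₂ g κ x y ⟩
    Σ (λ a → g (inj₁ x) (inj₁ a) *ₚ κ (inj₁ a) (inj₂ y)) (X-part x y) +ₚ Σ V (Y.interval (σ x) y)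
      ≈⟨ +ₚ-congʳ (Σ V (Y.interval (σ x) y)) (g⊛κ-X-part x y σx≤y) ⟩
    Σ T (Y.interval (σ x) y) +ₚ Σ V (Y.interval (σ x) y)
      ≈⟨ Σ-+ₚ T V (Y.interval (σ x) y) ⟨
    Σ (λ c → T c +ₚ V c) (Y.interval (σ x) y)
      ≈⟨ Σ-cong (Y.interval (σ x) y) (λ {c} _ →
           *ₚ-distribʳ-+ₚ (t-1 *ₚ h (inj₁ x) (inj₂ c)) (g (inj₁ x) (inj₂ c)) (κ (inj₂ c) (inj₂ y))) ⟨
    Σ (λ c → (t-1 *ₚ h (inj₁ x) (inj₂ c) +ₚ g (inj₁ x) (inj₂ c)) *ₚ κ (inj₂ c) (inj₂ y)) (Y.interval (σ x) y)
      ∎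
    where
    open ≋-Reasoning
    T V : Y.Carrier → Poly
    T c = t-1 *ₚ h (inj₁ x) (inj₂ c) *ₚ κ (inj₂ c) (inj₂ y)
    V c = g (inj₁ x) (inj₂ c) *ₚ κ (inj₂ c) (inj₂ y)

  h-inj₁-inj₂ : ∀ x {y} → σ x Y.≤ y →
    h (inj₁ x) (inj₂ y) ≋ Σ (λ c → ℓ (inj₁ x) (inj₂ c) *ₚ g (inj₂ c) (inj₂ y)) (Y.interval (σ x) y)
  h-inj₁-inj₂ x {y} σx≤y = ≋-trans (≋-sym (ℓ⊛g≋h σx≤y))
    (⊛-inj₁-inj₂-Y-part ℓ g x y (ℓ-∣X≋0 x _))

  g-inj₁-inj₂ : ∀ x {y} → σ x Y.≤ y → g (inj₁ x) (inj₂ y) ≋ _⊛_ Γ Δℓ g (inj₁ x) (inj₂ y)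
  g-inj₁-inj₂ x {y} σx≤y = ≋-trans
    (RelativeKLS.U≋Δₚ[L]◃G Y
      (r ∣Y) (IsWeakRankFunction-∣Y r-weak) (g ∣Y) (κ ∣Y) (InIHalf-∣Y r g g-half)
      (λ c → g-unit (inj₂ c)) (λ c → κ-unit (inj₂ c))
      (λ {c} {c'} c≤c' → ≋-trans (g-rev c≤c') (≡⇒≋ (⊛-∣Y g κ c c')))
      (σ x) (λ c → r (inj₁ x) (inj₂ c))
      (λ {c} σx≤c → proj₁ r-weak (inj₁ x) (inj₂ c) (σx≤c , λ ()))
      (λ {c'} {c} σx≤c' c'≤c → proj₂ r-weak (inj₁ x) (inj₂ c') (inj₂ c) σx≤c' c'≤c)
      (λ c → g (inj₁ x) (inj₂ c)) (λ c → h (inj₁ x) (inj₂ c)) (λ c → ℓ (inj₁ x) (inj₂ c))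
      (λ {c} σx≤c → proj₂ g-half (inj₁ x) (inj₂ c) (σx≤c , λ ()))
      (revₚ-g-inj₁-inj₂ x) (h-inj₁-inj₂ x) σx≤y)
    (≋-sym (⊛-inj₁-inj₂-Y-part Δℓ g x y Δℓ-∣X≋0))

  g-∣XY≈Δℓ⊛g : _≈ᴵ_ Γ (restrXY X Y ρX ρY σ g) (_⊛_ Γ Δℓ g)
  g-∣XY≈Δℓ⊛g (inj₁ a) (inj₁ a') _ = coeff-≡ (≋-sym (≋-trans (≡⇒≋ (⊛-∣X Δℓ g a a'))
    (⊛-≋0ˡ X.ord (Δℓ ∣X) (g ∣X) a a' λ a≤b _ → Δℓ-∣X≋0 a≤b)))
  g-∣XY≈Δℓ⊛g (inj₂ y) (inj₂ y') _ = coeff-≡ (≋-sym (≋-trans (≡⇒≋ (⊛-∣Y Δℓ g y y'))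
    (⊛-≋0ˡ Y.ord (Δℓ ∣Y) (g ∣Y) y y' λ y≤c _ → Δℓ-∣Y≋0 y≤c)))
  g-∣XY≈Δℓ⊛g (inj₁ x) (inj₂ y) σx≤y = coeff-≡ (g-inj₁-inj₂ x σx≤y)

  Δℓ⊛g≈Δℓ⊛g-∣Y : _≈ᴵ_ Γ (_⊛_ Γ Δℓ g) (_⊛_ Γ Δℓ (restrY X Y ρX ρY σ g))
  Δℓ⊛g≈Δℓ⊛g-∣Y z z' _ = coeff-≡ (⊛-cong-interval Γ Δℓ Δℓ g (restrY X Y ρX ρY σ g) z z' (term z _ z'))
    where
    term : ∀ z w z' → z ≤Γ w → w ≤Γ z' → Δℓ z w *ₚ g w z' ≋ Δℓ z w *ₚ restrY X Y ρX ρY σ g w z'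
    term z        (inj₂ _) (inj₂ _) _   _  = ≋-refl
    term (inj₁ _) (inj₁ b) z'       a≤b _  = ≋-trans (*ₚ-congʳ (g (inj₁ b) z') (Δℓ-∣X≋0 a≤b))
      (≋-sym (*ₚ-congʳ (restrY X Y ρX ρY σ g (inj₁ b) z') (Δℓ-∣X≋0 a≤b)))
    term (inj₂ _) (inj₁ _) _        ()  _
    term _        (inj₂ _) (inj₁ _) _   ()

theorem3p10 :
  (X Y : FinPoset) (ρX : FinPoset.Carrier X → ℤ) (ρY : FinPoset.Carrier Y → ℤ) →
  IsLowerEulerian X ρX → IsLowerEulerian Y ρY →
  (σ : FinPoset.Carrier X → FinPoset.Carrier Y) →
  IsStrongFormalSubdivision X Y ρX ρY σ →
  (r : WeakRank (Cyl X Y ρX ρY σ)) → IsWeakRankFunction (Cyl X Y ρX ρY σ) r →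
  (κ : Inc (Cyl X Y ρX ρY σ)) →
  InI (Cyl X Y ρX ρY σ) r κ → InU (Cyl X Y ρX ρY σ) κ →
  IsMultiplicative (Cyl X Y ρX ρY σ) κ →
  IsRankAlternating (Cyl X Y ρX ρY σ) r (ρCyl X Y ρX ρY σ) κ →
  (g : Inc (Cyl X Y ρX ρY σ)) → IsLeftKLS (Cyl X Y ρX ρY σ) r κ g →
  (h : Inc (Cyl X Y ρX ρY σ)) → IsHσ X Y ρX ρY σ κ g h →
  (ℓ : Inc (Cyl X Y ρX ρY σ)) → IsLσ X Y ρX ρY σ g h ℓ →
  _≈ᴵ_ (Cyl X Y ρX ρY σ) (restrXY X Y ρX ρY σ g)
    (_⊛_ (Cyl X Y ρX ρY σ) (Δ (Cyl X Y ρX ρY σ) r ℓ) g)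
  ×
  _≈ᴵ_ (Cyl X Y ρX ρY σ) (_⊛_ (Cyl X Y ρX ρY σ) (Δ (Cyl X Y ρX ρY σ) r ℓ) g)
    (_⊛_ (Cyl X Y ρX ρY σ) (Δ (Cyl X Y ρX ρY σ) r ℓ) (restrY X Y ρX ρY σ g))
-- Only the monotonicity of σ is used: the remaining hypotheses serve in the paper to
-- construct g, h_σ and ℓ_σ, which are given here together with their defining relations.
theorem3p10 X Y ρX ρY _ _ σ σ-subdivision r r-weak κ _ κ-unit κ-mult _ g g-KLS h h-def ℓ ℓ-def =
  g-∣XY≈Δℓ⊛g , Δℓ⊛g≈Δℓ⊛g-∣Y
  where open Subdivision X Y ρX ρY σ (proj₁ σ-subdivision) r r-weak κ κ-unit κ-mult g g-KLS h h-def ℓ ℓ-def
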